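{- For the cardinality $n$ of a $q^r$-divisible set $\mathcal{C}$ over $\mathbb{F}_q$ we have $$n\notin\left[(a(q-1)+b)\frac{q^{r+1}-1}{q-1}+a+1,\ (a(q-1)+b+1)\frac{q^{r+1}-1}{q-1}-1\right],$$ where $a,b\in\mathbb{N}_0$ with $b\le q-2$, $a\le r-1$, and $r\in\mathbb{N}_{>0}$. In other words, if $n\le rq^{r+1}$, then $n$ can be written as $a\frac{q^{r+1}-1}{q-1}+bq^{r+1}$ for some $a,b\in\mathbb{N}_0$.
   Context: $q$ is a prime power. A set $\mathcal{C}$ of points ($1$-dimensional subspaces) of $\mathbb{F}_q^v$ is called $q^r$-divisible if $|\{P\in\mathcal{C}: P\subseteq H\}|\equiv|\mathcal{C}|\pmod{q^r}$ for every hyperplane $H$ of $\mathbb{F}_q^v$; a $q^r$-divisible set over $\mathbb{F}_q$ means such a set for some ambient dimension $v$. -}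

module Defs where

open import Data.Nat as ℕ using (ℕ; zero; suc)
open import Data.Integer as ℤ using (ℤ; +_)
open import Data.Integer.Divisibility using () renaming (_∣_ to _∣ℤ_)
open import Data.Fin using (Fin)
open import Data.List using (List; []; _∷_; length; filter)
open import Data.List.Membership.Propositional using (_∈_)
open import Data.List.Relation.Unary.Unique.Propositional using (Unique)
open import Data.List.Relation.Unary.All using (All)
open import Data.List.Relation.Unary.AllPairs using (AllPairs)
open import Data.Product using (∃; Σ; _×_)
open import Relation.Nullary using (¬_; Dec)
open import Relation.Binary.PropositionalEquality using (_≡_)
open import Algebra.Structures using (IsCommutativeRing)
open import Data.Vec.Functional using (Vector) renaming (foldr to vfoldr)

record FiniteField : Set₁ where
  field
    Carrier  : Set
    _+_ _*_  : Carrier → Carrier → Carrier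
    -_       : Carrier → Carrier
    0# 1#    : Carrier
    isCommutativeRing : IsCommutativeRing _≡_ _+_ _*_ -_ 0# 1#
    0≢1      : ¬ (0# ≡ 1#)
    inverse  : ∀ x → ¬ (x ≡ 0#) → ∃ λ y → x * y ≡ 1#
    _≟_      : (x y : Carrier) → Dec (x ≡ y)
    elements : List Carrier
    elements-unique   : Unique elements
    elements-complete : ∀ x → x ∈ elements

  order : ℕ
  order = length elements

module _ (F : FiniteField) where
  open FiniteField F

  Vec : ℕ → Set
  Vec v = Vector Carrier v

  NonZeroVec : ∀ {v} → Vec v → Set
  NonZeroVec u = ¬ (∀ k → u k ≡ 0#)

  -- u and w span the same 1-dimensional subspace (for nonzero vectors)
  SamePoint : ∀ {v} → Vec v → Vec v → Set
  SamePoint u w = ∃ λ c → ∀ k → u k ≡ c * w k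

  -- a set of points of PG(v-1,q): a list of nonzero representatives,
  -- no two of which represent the same point
  record PointSet (v : ℕ) : Set where
    field
      reps     : List (Vec v)
      nonzero  : All NonZeroVec reps
      distinct : AllPairs (λ u w → ¬ SamePoint u w) reps

  dot : ∀ {v} → Vec v → Vec v → Carrier
  dot {v} h u = vfoldr _+_ 0# (λ k → h k * u k)

  -- hyperplanes are the kernels of nonzero functionals h;
  -- number of points of C contained in the hyperplane ker h
  pointsIn : ∀ {v} → PointSet v → Vec v → ℕ
  pointsIn C h = length (filter (λ u → dot h u ≟ 0#) (PointSet.reps C))

  size : ∀ {v} → PointSet v → ℕ
  size C = length (PointSet.reps C)

  Divisible : ℕ → ∀ {v} → PointSet v → Set
  Divisible r C = ∀ h → NonZeroVec h →
    (+ (order ℕ.^ r)) ∣ℤ ((+ pointsIn C h) ℤ.- (+ size C))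

-- [r+1]_q = (q^{r+1} - 1)/(q - 1) = 1 + q + ... + q^r
θ : ℕ → ℕ → ℕ
θ q zero    = 1
θ q (suc r) = q ℕ.^ (suc r) ℕ.+ θ q r

module Submission where

-- For a functional g let K_g = |C ∩ ker g|; divisibility says K_g ≡ n (mod q^r), n = |C|. Counting
-- along pencils of functionals gives the first two moments of K over all g ∈ F^v, and since each K_g
-- lies in the residue class of n, Σ_g (K_g − α)(K_g − α − q^r) ≥ 0 for α ≡ n. With p = q − 1 and
-- α = n − (c+1)q^r this reads (pn − c·q^(r+1))((c+1)q^(r+1) − pn) ≤ pn. For n in the (a, b)-gap this
-- pins pn just above c·q^(r+1); an averaging argument provides a hyperplane H with q·|C ∩ H| < n,
-- and C ∩ H, being q^(r−1)-divisible, then lies in a gap of lower index, so induction on r excludes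
-- all gaps. The representation of small n is arithmetic: n = c·θ + e with c = a'p + b' and e < θ
-- lies outside the (a', b')-gap only if e ≤ a', and then n = ((a' − e)p + b')θ + e·q^(r+1).

open import Defs
open import Data.Nat using (ℕ; zero; suc; _+_; _*_; _∸_; _^_; _≤_; _<_; _≤?_; _<?_; z≤n; s≤s; s≤s⁻¹; z<s; NonZero; >-nonZero)
open import Data.Nat.Properties hiding (_≟_)
open import Data.Nat.DivMod using (_/_; _%_; m≡m%n+[m/n]*n; m%n<n)
import Data.Nat.Divisibility as ℕ∣
open import Data.Nat.Tactic.RingSolver using (solve-∀)
open import Data.Integer as ℤ using (ℤ; +_; -[1+_]; +≤+)
import Data.Integer.Properties as ℤ
import Data.Integer.Tactic.RingSolver as ℤ-Solver
open import Data.Integer.Divisibility.Signed as ℤ∣ using (divides) renaming (_∣_ to _∣ℤ_)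
open import Data.Fin using () renaming (zero to fzero; suc to fsuc)
import Data.Fin.Properties as Fin
open import Data.List using (List; []; _∷_; length; filter; map; concatMap; _++_)
open import Data.List.Membership.Propositional using (_∈_)
open import Data.List.Membership.Propositional.Properties using (∈-map⁺; ∈-concatMap⁺)
open import Data.List.Relation.Unary.All as All using (All; []; _∷_)
import Data.List.Relation.Unary.All.Properties as Allₚ
open import Data.List.Relation.Unary.AllPairs using (AllPairs; []; _∷_)
import Data.List.Relation.Unary.AllPairs.Properties as AllPairsₚ
open import Data.List.Relation.Unary.Any as Any using (here; there; any?; satisfied)
open import Data.List.Relation.Unary.Unique.Propositional using (Unique)
open import Data.Vec.Functional using (head; tail) renaming (_∷_ to _∷ᵛ_)
open import Data.Product using (∃; ∃₂; _×_; _,_; proj₁)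
open import Data.Empty using (⊥-elim)
open import Function using (_∘_)
open import Relation.Nullary using (¬_; Dec; yes; no; contradiction)
open import Relation.Binary.PropositionalEquality
open import Level using (0ℓ)
open import Algebra.Bundles using (CommutativeRing)
import Algebra.Properties.Group as GroupProperties
import Algebra.Properties.Ring as RingProperties
import Algebra.Solver.Ring.NaturalCoefficients.Default as SemiringSolver
open FiniteField using (order)

𝟙 : ∀ {p} {P : Set p} → Dec P → ℕ
𝟙 (yes _) = 1
𝟙 (no _)  = 0

module _ {p q} {P : Set p} {Q : Set q} where

  𝟙-cong : (d : Dec P) (e : Dec Q) → (P → Q) → (Q → P) → 𝟙 d ≡ 𝟙 e
  𝟙-cong (yes _) (yes _) _   _   = refl
  𝟙-cong (yes p) (no ¬q) p→q _   = contradiction (p→q p) ¬q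
  𝟙-cong (no ¬p) (yes q) _   q→p = contradiction (q→p q) ¬p
  𝟙-cong (no _)  (no _)  _   _   = refl

𝟙-yes : ∀ {p} {P : Set p} (d : Dec P) → P → 𝟙 d ≡ 1
𝟙-yes (yes _) _ = refl
𝟙-yes (no ¬p) p = contradiction p ¬p

𝟙-no : ∀ {p} {P : Set p} (d : Dec P) → ¬ P → 𝟙 d ≡ 0
𝟙-no (yes p) ¬p = contradiction p ¬p
𝟙-no (no _)  _  = refl

𝟙-idem : ∀ {p} {P : Set p} (d : Dec P) → 𝟙 d * 𝟙 d ≡ 𝟙 d
𝟙-idem (yes _) = refl
𝟙-idem (no _)  = refl

module _ {a} {A : Set a} where

  ∑ : List A → (A → ℕ) → ℕ
  ∑ []       f = 0
  ∑ (x ∷ xs) f = f x + ∑ xs f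

  ∑-cong : ∀ xs {f g : A → ℕ} → (∀ x → f x ≡ g x) → ∑ xs f ≡ ∑ xs g
  ∑-cong []       f≗g = refl
  ∑-cong (x ∷ xs) f≗g = cong₂ _+_ (f≗g x) (∑-cong xs f≗g)

  ∑-congᴬ : ∀ {xs} {f g : A → ℕ} → All (λ x → f x ≡ g x) xs → ∑ xs f ≡ ∑ xs g
  ∑-congᴬ []           = refl
  ∑-congᴬ (fx≡gx ∷ eqs) = cong₂ _+_ fx≡gx (∑-congᴬ eqs)

  ∑-+ : ∀ xs (f g : A → ℕ) → ∑ xs (λ x → f x + g x) ≡ ∑ xs f + ∑ xs g
  ∑-+ []       f g = refl
  ∑-+ (x ∷ xs) f g = begin
    f x + g x + ∑ xs (λ x → f x + g x) ≡⟨ cong (_+_ (f x + g x)) (∑-+ xs f g) ⟩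
    f x + g x + (∑ xs f + ∑ xs g)      ≡⟨ +-+-comm (f x) (g x) (∑ xs f) (∑ xs g) ⟩
    f x + ∑ xs f + (g x + ∑ xs g)      ∎
    where
    open ≡-Reasoning
    +-+-comm : ∀ a b c d → a + b + (c + d) ≡ a + c + (b + d)
    +-+-comm = solve-∀

  ∑-* : ∀ xs k (f : A → ℕ) → ∑ xs (λ x → k * f x) ≡ k * ∑ xs f
  ∑-* []       k f = sym (*-zeroʳ k)
  ∑-* (x ∷ xs) k f = trans (cong (_+_ (k * f x)) (∑-* xs k f)) (sym (*-distribˡ-+ k (f x) (∑ xs f)))

  ∑-const : ∀ xs k → ∑ xs (λ _ → k) ≡ length xs * k
  ∑-const []       k = refl
  ∑-const (x ∷ xs) k = cong (_+_ k) (∑-const xs k)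

  ∑-++ : ∀ xs ys (f : A → ℕ) → ∑ (xs ++ ys) f ≡ ∑ xs f + ∑ ys f
  ∑-++ []       ys f = refl
  ∑-++ (x ∷ xs) ys f = trans (cong (_+_ (f x)) (∑-++ xs ys f)) (sym (+-assoc (f x) _ _))

  length≡∑1 : ∀ xs → length xs ≡ ∑ xs (λ _ → 1)
  length≡∑1 xs = sym (trans (∑-const xs 1) (*-identityʳ (length xs)))

  length-filter≡∑𝟙 : ∀ {p} {P : A → Set p} (P? : ∀ x → Dec (P x)) xs →
                     length (filter P? xs) ≡ ∑ xs (λ x → 𝟙 (P? x))
  length-filter≡∑𝟙 P? []       = refl
  length-filter≡∑𝟙 P? (x ∷ xs) with P? x
  ... | yes _ = cong suc (length-filter≡∑𝟙 P? xs)
  ... | no  _ = length-filter≡∑𝟙 P? xs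

  ∑-filter : ∀ {p} {P : A → Set p} (P? : ∀ x → Dec (P x)) xs (f : A → ℕ) →
             ∑ (filter P? xs) f ≡ ∑ xs (λ x → 𝟙 (P? x) * f x)
  ∑-filter P? []       f = refl
  ∑-filter P? (x ∷ xs) f with P? x
  ... | yes _ = cong₂ _+_ (sym (+-identityʳ (f x))) (∑-filter P? xs f)
  ... | no  _ = ∑-filter P? xs f

  ∑-single : ∀ {xs} (f : A → ℕ) {x₀} → Unique xs → x₀ ∈ xs →
             (∀ x → ¬ x ≡ x₀ → f x ≡ 0) → ∑ xs f ≡ f x₀
  ∑-single {x ∷ xs} f (x∉xs ∷ !xs) (here refl) f≡0 =
    trans (cong (_+_ (f x)) (vanish x∉xs)) (+-identityʳ (f x))
    where
    vanish : ∀ {ys} → All (λ y → ¬ x ≡ y) ys → ∑ ys f ≡ 0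
    vanish []           = refl
    vanish (x≢y ∷ x≢ys) = cong₂ _+_ (f≡0 _ (x≢y ∘ sym)) (vanish x≢ys)
  ∑-single {x ∷ xs} f (x∉xs ∷ !xs) (there x₀∈xs) f≡0 =
    trans (cong (_+ ∑ xs f) (f≡0 x x≢x₀)) (∑-single f !xs x₀∈xs f≡0)
    where
    x≢x₀ : ¬ x ≡ _
    x≢x₀ refl = distinct x∉xs x₀∈xs
      where
      distinct : ∀ {ys} → All (λ y → ¬ x ≡ y) ys → ¬ x ∈ ys
      distinct (x≢y ∷ _)   (here x≡y)  = x≢y x≡y
      distinct (_ ∷ x≢ys) (there x∈ys) = distinct x≢ys x∈ys

  ∑-mono-≤ : ∀ {xs} {f g : A → ℕ} → All (λ x → f x ≤ g x) xs → ∑ xs f ≤ ∑ xs g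
  ∑-mono-≤ []            = z≤n
  ∑-mono-≤ (fx≤gx ∷ f≤g) = +-mono-≤ fx≤gx (∑-mono-≤ f≤g)

  ∑-mono-< : ∀ {xs} {f g : A → ℕ} {x₀} → All (λ x → f x ≤ g x) xs → x₀ ∈ xs → f x₀ < g x₀ →
             ∑ xs f < ∑ xs g
  ∑-mono-< (_ ∷ f≤g) (here refl) fx₀<gx₀ = +-mono-<-≤ fx₀<gx₀ (∑-mono-≤ f≤g)
  ∑-mono-< (fx≤gx ∷ f≤g) (there x₀∈xs) fx₀<gx₀ = +-mono-≤-< fx≤gx (∑-mono-< f≤g x₀∈xs fx₀<gx₀)

  ∑-≡⇒∃< : ∀ xs {f g : A → ℕ} {x₀} → ∑ xs f ≡ ∑ xs g → x₀ ∈ xs → g x₀ < f x₀ → ∃ λ x → f x < g x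
  ∑-≡⇒∃< xs {f} {g} ∑f≡∑g x₀∈xs gx₀<fx₀ with any? (λ x → f x <? g x) xs
  ... | yes some = satisfied some
  ... | no  none = contradiction ∑f≡∑g (<⇒≢ (∑-mono-< g≤f x₀∈xs gx₀<fx₀) ∘ sym)
    where
    g≤f : All (λ x → g x ≤ f x) xs
    g≤f = All.map ≮⇒≥ (Allₚ.¬Any⇒All¬ xs none)

module _ {a b} {A : Set a} {B : Set b} where

  ∑-map : ∀ xs (h : A → B) (f : B → ℕ) → ∑ (map h xs) f ≡ ∑ xs (λ x → f (h x))
  ∑-map []       h f = refl
  ∑-map (x ∷ xs) h f = cong (_+_ (f (h x))) (∑-map xs h f)

  ∑-concatMap : ∀ xs (h : A → List B) (f : B → ℕ) → ∑ (concatMap h xs) f ≡ ∑ xs (λ x → ∑ (h x) f)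
  ∑-concatMap []       h f = refl
  ∑-concatMap (x ∷ xs) h f = trans (∑-++ (h x) (concatMap h xs) f) (cong (_+_ (∑ (h x) f)) (∑-concatMap xs h f))

  ∑-swap : ∀ xs ys (f : A → B → ℕ) → ∑ xs (λ x → ∑ ys (f x)) ≡ ∑ ys (λ y → ∑ xs (λ x → f x y))
  ∑-swap []       ys f = sym (trans (∑-const ys 0) (*-zeroʳ (length ys)))
  ∑-swap (x ∷ xs) ys f = trans (cong (_+_ (∑ ys (f x))) (∑-swap xs ys f)) (sym (∑-+ ys (f x) _))

module _ {a} {A : Set a} where

  ∑ᶻ : List A → (A → ℤ) → ℤ
  ∑ᶻ []       f = + 0
  ∑ᶻ (x ∷ xs) f = f x ℤ.+ ∑ᶻ xs f

  ∑ᶻ-nonneg : ∀ xs (f : A → ℤ) → (∀ x → + 0 ℤ.≤ f x) → + 0 ℤ.≤ ∑ᶻ xs f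
  ∑ᶻ-nonneg []       f f≥0 = ℤ.≤-refl
  ∑ᶻ-nonneg (x ∷ xs) f f≥0 = ℤ.+-mono-≤ (f≥0 x) (∑ᶻ-nonneg xs f f≥0)

  ∑ᶻ-quadratic : ∀ xs (f : A → ℕ) α β →
                 ∑ᶻ xs (λ x → (+ f x ℤ.- α) ℤ.* (+ f x ℤ.- β))
                 ≡ + ∑ xs (λ x → f x * f x) ℤ.- (α ℤ.+ β) ℤ.* + ∑ xs f ℤ.+ α ℤ.* β ℤ.* + length xs
  ∑ᶻ-quadratic []       f α β = e α β
    where
    e : ∀ α β → + 0 ≡ + 0 ℤ.- (α ℤ.+ β) ℤ.* + 0 ℤ.+ α ℤ.* β ℤ.* + 0
    e = ℤ-Solver.solve-∀
  ∑ᶻ-quadratic (x ∷ xs) f α β = begin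
    (+ f x ℤ.- α) ℤ.* (+ f x ℤ.- β) ℤ.+ ∑ᶻ xs (λ x → (+ f x ℤ.- α) ℤ.* (+ f x ℤ.- β))
      ≡⟨ cong (λ s → (+ f x ℤ.- α) ℤ.* (+ f x ℤ.- β) ℤ.+ s) (∑ᶻ-quadratic xs f α β) ⟩
    (+ f x ℤ.- α) ℤ.* (+ f x ℤ.- β) ℤ.+ (+ S₂ ℤ.- (α ℤ.+ β) ℤ.* + S₁ ℤ.+ α ℤ.* β ℤ.* + l)
      ≡⟨ e (+ f x) (+ S₂) (+ S₁) (+ l) α β ⟩
    (+ f x ℤ.* + f x ℤ.+ + S₂) ℤ.- (α ℤ.+ β) ℤ.* (+ f x ℤ.+ + S₁) ℤ.+ α ℤ.* β ℤ.* (+ 1 ℤ.+ + l)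
      ≡⟨ cong₂ (λ s₂ s₁ → s₂ ℤ.- (α ℤ.+ β) ℤ.* s₁ ℤ.+ α ℤ.* β ℤ.* (+ 1 ℤ.+ + l))
               (trans (cong (ℤ._+ + S₂) (sym (ℤ.pos-* (f x) (f x)))) (sym (ℤ.pos-+ (f x * f x) S₂)))
               (sym (ℤ.pos-+ (f x) S₁)) ⟩
    + (f x * f x + S₂) ℤ.- (α ℤ.+ β) ℤ.* + (f x + S₁) ℤ.+ α ℤ.* β ℤ.* + suc l ∎
    where
    open ≡-Reasoning
    S₁ : ℕ
    S₁ = ∑ xs f
    S₂ : ℕ
    S₂ = ∑ xs (λ x → f x * f x)
    l : ℕ
    l = length xs
    e : ∀ k s₂ s₁ l α β → (k ℤ.- α) ℤ.* (k ℤ.- β) ℤ.+ (s₂ ℤ.- (α ℤ.+ β) ℤ.* s₁ ℤ.+ α ℤ.* β ℤ.* l)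
                        ≡ (k ℤ.* k ℤ.+ s₂) ℤ.- (α ℤ.+ β) ℤ.* (k ℤ.+ s₁) ℤ.+ α ℤ.* β ℤ.* (+ 1 ℤ.+ l)
    e = ℤ-Solver.solve-∀

infix 4 _≡_mod_
_≡_mod_ : ℕ → ℕ → ℕ → Set
_≡_mod_ m n d = + d ∣ℤ + m ℤ.- + n

≡-mod-refl : ∀ {n d} → n ≡ n mod d
≡-mod-refl {n} {d} = divides (+ 0) (trans (ℤ.+-inverseʳ (+ n)) (sym (ℤ.*-zeroˡ (+ d))))

≡-mod⇒∃ : ∀ {m n d} → m ≤ n → m ≡ n mod d → ∃ λ J → m + J * d ≡ n
≡-mod⇒∃ {m} {n} {d} m≤n m≡n with ℤ∣.∣⇒∣ᵤ m≡n
... | ℕ∣.divides J ∣m-n∣≡Jd = J , (begin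
  m + J * d    ≡⟨ cong (λ k → m + k) (trans (sym ∣m-n∣≡Jd) ∣m-n∣≡n∸m) ⟩
  m + (n ∸ m)  ≡⟨ m+[n∸m]≡n m≤n ⟩
  n            ∎)
  where
  open ≡-Reasoning
  ∣m-n∣≡n∸m : ℤ.∣ + m ℤ.- + n ∣ ≡ n ∸ m
  ∣m-n∣≡n∸m = trans (cong ℤ.∣_∣ (ℤ.m-n≡m⊖n m n)) (ℤ.∣⊖∣-≤ m≤n)

∑-≡-mod : ∀ {a} {A : Set a} (xs : List A) {f : A → ℕ} {n d} → (∀ x → f x ≡ n mod d) → ∑ xs f ≡ length xs * n mod d
∑-≡-mod []       f≡n = divides (+ 0) refl
∑-≡-mod (x ∷ xs) {f} {n} {d} f≡n = subst (+ d ∣ℤ_) (sym split) (ℤ∣.∣m∣n⇒∣m+n (f≡n x) (∑-≡-mod xs f≡n))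
  where
  split : + (f x + ∑ xs f) ℤ.- + (n + length xs * n) ≡ (+ f x ℤ.- + n) ℤ.+ (+ ∑ xs f ℤ.- + (length xs * n))
  split = trans (cong₂ ℤ._-_ (ℤ.pos-+ (f x) _) (ℤ.pos-+ n _)) (e (+ f x) (+ ∑ xs f) (+ n) (+ (length xs * n)))
    where
    e : ∀ a b c d → (a ℤ.+ b) ℤ.- (c ℤ.+ d) ≡ (a ℤ.- c) ℤ.+ (b ℤ.- d)
    e = ℤ-Solver.solve-∀

+a≡+c-+b : ∀ {a b c} → a + b ≡ c → + a ≡ + c ℤ.- + b
+a≡+c-+b {a} {b} refl = trans (e (+ a) (+ b)) (cong (ℤ._- + b) (sym (ℤ.pos-+ a b)))
  where
  e : ∀ a b → a ≡ a ℤ.+ b ℤ.- b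
  e = ℤ-Solver.solve-∀

m*[m+1]≥0 : ∀ m → + 0 ℤ.≤ m ℤ.* (m ℤ.+ + 1)
m*[m+1]≥0 (+ k)      = subst (+ 0 ℤ.≤_) (ℤ.pos-* k (k + 1)) (+≤+ z≤n)
m*[m+1]≥0 -[1+ k ]   = subst (+ 0 ℤ.≤_) (sym (trans (e (+ k)) (sym (ℤ.pos-* (suc k) k)))) (+≤+ z≤n)
  where
  e : ∀ k → (ℤ.- (+ 1 ℤ.+ k)) ℤ.* (ℤ.- (+ 1 ℤ.+ k) ℤ.+ + 1) ≡ (+ 1 ℤ.+ k) ℤ.* k
  e = ℤ-Solver.solve-∀

+k*i≥0 : ∀ k {i} → + 0 ℤ.≤ i → + 0 ℤ.≤ + k ℤ.* i
+k*i≥0 k {+ m} _ = subst (+ 0 ℤ.≤_) (ℤ.pos-* k m) (+≤+ z≤n)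

-- The two factors are consecutive multiples of Δ.
consecutive-multiples : ∀ {K n} Δ c → K ≡ n mod Δ →
                        + 0 ℤ.≤ (+ K ℤ.- (+ n ℤ.- (c ℤ.+ + 1) ℤ.* + Δ)) ℤ.* (+ K ℤ.- (+ n ℤ.- c ℤ.* + Δ))
consecutive-multiples {K} {n} Δ c (divides k K-n≡kΔ) =
  subst (+ 0 ℤ.≤_) (sym product≡) (+k*i≥0 (Δ * Δ) (m*[m+1]≥0 (k ℤ.+ c)))
  where
  product≡ : (+ K ℤ.- (+ n ℤ.- (c ℤ.+ + 1) ℤ.* + Δ)) ℤ.* (+ K ℤ.- (+ n ℤ.- c ℤ.* + Δ))
             ≡ + (Δ * Δ) ℤ.* ((k ℤ.+ c) ℤ.* (k ℤ.+ c ℤ.+ + 1))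
  product≡ = begin
    (+ K ℤ.- (+ n ℤ.- (c ℤ.+ + 1) ℤ.* + Δ)) ℤ.* (+ K ℤ.- (+ n ℤ.- c ℤ.* + Δ))
      ≡⟨ e₁ (+ K) (+ n) (+ Δ) c ⟩
    ((+ K ℤ.- + n) ℤ.+ (c ℤ.+ + 1) ℤ.* + Δ) ℤ.* ((+ K ℤ.- + n) ℤ.+ c ℤ.* + Δ)
      ≡⟨ cong (λ d → (d ℤ.+ (c ℤ.+ + 1) ℤ.* + Δ) ℤ.* (d ℤ.+ c ℤ.* + Δ)) K-n≡kΔ ⟩
    (k ℤ.* + Δ ℤ.+ (c ℤ.+ + 1) ℤ.* + Δ) ℤ.* (k ℤ.* + Δ ℤ.+ c ℤ.* + Δ)
      ≡⟨ e₂ k (+ Δ) c ⟩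
    + Δ ℤ.* + Δ ℤ.* ((k ℤ.+ c) ℤ.* (k ℤ.+ c ℤ.+ + 1))
      ≡⟨ cong (ℤ._* ((k ℤ.+ c) ℤ.* (k ℤ.+ c ℤ.+ + 1))) (ℤ.pos-* Δ Δ) ⟨
    + (Δ * Δ) ℤ.* ((k ℤ.+ c) ℤ.* (k ℤ.+ c ℤ.+ + 1)) ∎
    where
    open ≡-Reasoning
    e₁ : ∀ K n Δ c → (K ℤ.- (n ℤ.- (c ℤ.+ + 1) ℤ.* Δ)) ℤ.* (K ℤ.- (n ℤ.- c ℤ.* Δ))
                   ≡ ((K ℤ.- n) ℤ.+ (c ℤ.+ + 1) ℤ.* Δ) ℤ.* ((K ℤ.- n) ℤ.+ c ℤ.* Δ)
    e₁ = ℤ-Solver.solve-∀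
    e₂ : ∀ k Δ c → (k ℤ.* Δ ℤ.+ (c ℤ.+ + 1) ℤ.* Δ) ℤ.* (k ℤ.* Δ ℤ.+ c ℤ.* Δ) ≡ Δ ℤ.* Δ ℤ.* ((k ℤ.+ c) ℤ.* (k ℤ.+ c ℤ.+ + 1))
    e₂ = ℤ-Solver.solve-∀

p*θ+1≡q^[1+r] : ∀ p r → p * θ (suc p) r + 1 ≡ suc p ^ suc r
p*θ+1≡q^[1+r] p zero    = e p
  where
  e : ∀ p → p * 1 + 1 ≡ suc p * 1
  e = solve-∀
p*θ+1≡q^[1+r] p (suc r) = begin-equality
  p * (q ^ suc r + θ q r) + 1     ≡⟨ e p (q ^ suc r) (θ q r) ⟩
  p * q ^ suc r + (p * θ q r + 1) ≡⟨ cong (_+_ (p * q ^ suc r)) (p*θ+1≡q^[1+r] p r) ⟩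
  p * q ^ suc r + q ^ suc r       ≡⟨ +-comm (p * q ^ suc r) _ ⟩
  q * q ^ suc r                   ∎
  where
  open ≤-Reasoning
  q : ℕ
  q = suc p
  e : ∀ p x y → p * (x + y) + 1 ≡ p * x + (p * y + 1)
  e = solve-∀

2r+1≤θ : ∀ p r → 1 ≤ p → 2 * r + 1 ≤ θ (suc p) r
2r+1≤θ p zero    _   = ≤-refl
2r+1≤θ p (suc r) 1≤p = begin
  2 * suc r + 1               ≡⟨ e r ⟩
  2 + (2 * r + 1)             ≤⟨ +-mono-≤ (*-mono-≤ (s≤s 1≤p) (m^n>0 (suc p) r)) (2r+1≤θ p r 1≤p) ⟩
  suc p ^ suc r + θ (suc p) r ∎
  where
  open ≤-Reasoning
  e : ∀ r → 2 * suc r + 1 ≡ 2 + (2 * r + 1)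
  e = solve-∀

-- For r ≥ 2 the step r ↦ r + 1 multiplies the right side by q but the left side by less,
-- the difference being the second summand below.
pronic<q^[1+r] : ∀ p r → 1 ≤ p → 1 ≤ r → r * p * (r * p + 1) < suc p ^ suc r
pronic<q^[1+r] (suc t) 1 _ _ = ≤-trans (m≤m+n _ (suc t)) (≤-reflexive (e t))
  where
  e : ∀ t → suc (1 * suc t * (1 * suc t + 1)) + suc t ≡ suc (suc t) * (suc (suc t) * 1)
  e = solve-∀
pronic<q^[1+r] (suc t) 2 _ _ = ≤-trans (m≤m+n _ (t * t * t + 2 * t * t + 2 * t + 1)) (≤-reflexive (e t))
  where
  e : ∀ t → suc (2 * suc t * (2 * suc t + 1)) + (t * t * t + 2 * t * t + 2 * t + 1)
          ≡ suc (suc t) * (suc (suc t) * (suc (suc t) * 1))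
  e = solve-∀
pronic<q^[1+r] (suc t) (suc (suc (suc s))) _ _ = begin
  suc (r * p * (r * p + 1))
    ≤⟨ m≤m+n _ (p * p * (s * s * t + 4 * s * t + 4 * t + s * s + 3 * s + 1)) ⟩
  suc (r * p * (r * p + 1)) + p * p * (s * s * t + 4 * s * t + 4 * t + s * s + 3 * s + 1)
    ≡⟨ e s t ⟩
  suc p * suc (suc (suc s) * p * (suc (suc s) * p + 1))
    ≤⟨ *-monoʳ-≤ (suc p) (pronic<q^[1+r] p (suc (suc s)) (s≤s z≤n) (s≤s z≤n)) ⟩
  suc p * suc p ^ r ∎
  where
  open ≤-Reasoning
  p : ℕ
  p = suc t
  r : ℕ
  r = suc (suc (suc s))
  e : ∀ s t → suc (suc (suc (suc s)) * suc t * (suc (suc (suc s)) * suc t + 1))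
                + suc t * suc t * (s * s * t + 4 * s * t + 4 * t + s * s + 3 * s + 1)
            ≡ suc (suc t) * suc (suc (suc s) * suc t * (suc (suc s) * suc t + 1))
  e = solve-∀

quadratic-gap : ∀ c A B → (c + 1) * (c + 2) < (c + 1 + A) + (c + 2 + B) →
                c * ((c + 1 + A) + (c + 2 + B)) + (c + 1 + A) < (c + 1 + A) * (c + 2 + B)
quadratic-gap c A B small = begin-strict
  c * S + X          ≤⟨ m≤m+n _ (A * B) ⟩
  c * S + X + A * B  <⟨ +-cancelʳ-< S _ _ (begin-strict
                          c * S + X + A * B + S  ≡⟨ e c A B ⟩
                          X * Y + (c + 1) * (c + 2) <⟨ +-monoʳ-< (X * Y) small ⟩
                          X * Y + S ∎) ⟩
  X * Y              ∎
  where
  open ≤-Reasoning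
  X : ℕ
  X = c + 1 + A
  Y : ℕ
  Y = c + 2 + B
  S : ℕ
  S = X + Y
  e : ∀ c A B → c * ((c + 1 + A) + (c + 2 + B)) + (c + 1 + A) + A * B + ((c + 1 + A) + (c + 2 + B))
              ≡ (c + 1 + A) * (c + 2 + B) + (c + 1) * (c + 2)
  e = solve-∀

InGap : (q r a b n : ℕ) → Set
InGap q r a b n = (a * (q ∸ 1) + b) * θ q r + a + 1 ≤ n × n ≤ (a * (q ∸ 1) + b + 1) * θ q r ∸ 1

QuadraticBound : (q r n : ℕ) → ℤ → Set
QuadraticBound q r n c = (pn ℤ.- c ℤ.* Q) ℤ.* ((c ℤ.+ + 1) ℤ.* Q ℤ.- pn) ℤ.≤ pn
  where
  pn : ℤ
  pn = + ((q ∸ 1) * n)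
  Q : ℤ
  Q = + (q ^ suc r)

QuadraticBound⇒*≤ : ∀ {m c Q} X Y → c * Q + X ≡ m → m + Y ≡ (c + 1) * Q →
                    (+ m ℤ.- + c ℤ.* + Q) ℤ.* ((+ c ℤ.+ + 1) ℤ.* + Q ℤ.- + m) ℤ.≤ + m →
                    X * Y ≤ m
QuadraticBound⇒*≤ {m} {c} {Q} X Y cQ+X≡m m+Y≡[c+1]Q bound =
  ℤ.drop‿+≤+ (subst (ℤ._≤ + m) (trans (cong₂ ℤ._*_ first second) (sym (ℤ.pos-* X Y))) bound)
  where
  +[k+x]-+k≡+x : ∀ k x → + (k + x) ℤ.- + k ≡ + x
  +[k+x]-+k≡+x k x = trans (ℤ.m-n≡m⊖n (k + x) k) (trans (ℤ.⊖-≥ (m≤m+n k x)) (cong +_ (m+n∸m≡n k x)))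
  first : + m ℤ.- + c ℤ.* + Q ≡ + X
  first = subst (λ k → + m ℤ.- k ≡ + X) (ℤ.pos-* c Q)
            (subst (λ m → + m ℤ.- + (c * Q) ≡ + X) cQ+X≡m (+[k+x]-+k≡+x (c * Q) X))
  second : (+ c ℤ.+ + 1) ℤ.* + Q ℤ.- + m ≡ + Y
  second = subst (λ k → k ℤ.* + Q ℤ.- + m ≡ + Y) (ℤ.pos-+ c 1)
             (subst (λ k → k ℤ.- + m ≡ + Y) (ℤ.pos-* (c + 1) Q)
               (subst (λ k → + k ℤ.- + m ≡ + Y) m+Y≡[c+1]Q (+[k+x]-+k≡+x m Y)))

-- With q = p + 1 and n = c·θ_{r+1} + e in the (a, b)-gap, the quadratic bound forces e ≤ 2a + 1; a
-- section of size n' = n − J·q^(r+1) < n/q then has c < J ≤ c + a, which puts n' into the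
-- (a − 1 − (J − c − 1), b)-gap one level down.
module Descent (p r a b : ℕ) (b<p : b < p) where

  open ≤-Reasoning

  q : ℕ
  q = suc p
  c : ℕ
  c = a * p + b
  Δ : ℕ
  Δ = q ^ suc r
  t : ℕ
  t = θ q r
  Q : ℕ
  Q = q * Δ

  1≤p : 1 ≤ p
  1≤p = ≤-<-trans z≤n b<p

  Δ≡p*t+1 : Δ ≡ p * t + 1
  Δ≡p*t+1 = sym (p*θ+1≡q^[1+r] p r)

  c+1≤[a+1]*p : c + 1 ≤ (a + 1) * p
  c+1≤[a+1]*p = begin
    a * p + b + 1   ≡⟨ +-assoc (a * p) b 1 ⟩
    a * p + (b + 1) ≤⟨ +-monoʳ-≤ (a * p) (≤-trans (≤-reflexive (+-comm b 1)) b<p) ⟩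
    a * p + p       ≡⟨ e a p ⟩
    (a + 1) * p     ∎
    where
    e : ∀ a p → a * p + p ≡ (a + 1) * p
    e = solve-∀

  pn+c≡cQ+pe : ∀ {n e} → c * (Δ + t) + e ≡ n → p * n + c ≡ c * Q + p * e
  pn+c≡cQ+pe {n} {e} n≡ = begin-equality
    p * n + c                    ≡⟨ cong (λ n → p * n + c) (sym n≡) ⟩
    p * (c * (Δ + t) + e) + c    ≡⟨ e′ p c (Δ + t) e ⟩
    c * (p * (Δ + t) + 1) + p * e ≡⟨ cong (λ x → c * x + p * e) (p*θ+1≡q^[1+r] p (suc r)) ⟩
    c * Q + p * e                ∎
    where
    e′ : ∀ p c θ e → p * (c * θ + e) + c ≡ c * (p * θ + 1) + p * e
    e′ = solve-∀

  excess : ∀ {n} → InGap q (suc r) a b n → ∃ λ e → c * (Δ + t) + e ≡ n × a + 1 ≤ e × e < Δ + t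
  excess {n} (lower , upper) with m≤n⇒∃[o]m+o≡n (≤-trans (m≤m+n (c * (Δ + t)) (a + 1)) (≤-trans (≤-reflexive (sym (+-assoc _ a 1))) lower))
  ... | e , n≡ = e , n≡ , +-cancelˡ-≤ (c * (Δ + t)) _ _ (begin
      c * (Δ + t) + (a + 1) ≡⟨ +-assoc (c * (Δ + t)) a 1 ⟨
      c * (Δ + t) + a + 1   ≤⟨ lower ⟩
      n                     ≡⟨ n≡ ⟨
      c * (Δ + t) + e       ∎)
    , +-cancelˡ-< (c * (Δ + t)) _ _ (begin-strict
      c * (Δ + t) + e       ≡⟨ n≡ ⟩
      n                     <⟨ m≤pred[n]⇒suc[m]≤n {{θ[c+1]≢0}} upper ⟩
      (c + 1) * (Δ + t)     ≡⟨ e′ c (Δ + t) ⟩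
      c * (Δ + t) + (Δ + t) ∎)
    where
    θ[c+1]≢0 : NonZero ((c + 1) * (Δ + t))
    θ[c+1]≢0 = >-nonZero (*-mono-≤ (m≤n+m 1 c) (≤-trans (m^n>0 q (suc r)) (m≤m+n Δ t)))
    e′ : ∀ c θ → (c + 1) * θ ≡ c * θ + θ
    e′ = solve-∀

  [c+1]*[c+2]<Q : a ≤ r → (c + 1) * (c + 2) < Q
  [c+1]*[c+2]<Q a≤r = begin-strict
    (c + 1) * (c + 2)                 ≡⟨ cong ((c + 1) *_) (+-assoc c 1 1) ⟨
    (c + 1) * (c + 1 + 1)             ≤⟨ *-mono-≤ c+1≤rp (+-monoˡ-≤ 1 c+1≤rp) ⟩
    suc r * p * (suc r * p + 1)       <⟨ pronic<q^[1+r] p (suc r) 1≤p (s≤s z≤n) ⟩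
    Q                                 ∎
    where
    c+1≤rp : c + 1 ≤ suc r * p
    c+1≤rp = ≤-trans c+1≤[a+1]*p (*-monoˡ-≤ p (≤-trans (≤-reflexive (+-comm a 1)) (s≤s a≤r)))

  pn+c+2≤[c+1]Q : ∀ {n e} → c * (Δ + t) + e ≡ n → e < Δ + t → p * n + c + 2 ≤ (c + 1) * Q
  pn+c+2≤[c+1]Q {n} {e} n≡ e<θ = begin
    p * n + c + 2             ≡⟨ cong (_+ 2) (pn+c≡cQ+pe n≡) ⟩
    c * Q + p * e + 2         ≤⟨ +-monoʳ-≤ (c * Q + p * e) (s≤s 1≤p) ⟩
    c * Q + p * e + suc p     ≡⟨ e₁ (c * Q) p e ⟩
    c * Q + (p * suc e + 1)   ≤⟨ +-monoʳ-≤ (c * Q) (+-monoˡ-≤ 1 (*-monoʳ-≤ p e<θ)) ⟩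
    c * Q + (p * (Δ + t) + 1) ≡⟨ cong (_+_ (c * Q)) (p*θ+1≡q^[1+r] p (suc r)) ⟩
    c * Q + Q                 ≡⟨ e₂ c Q ⟩
    (c + 1) * Q               ∎
    where
    e₁ : ∀ x p e → x + p * e + suc p ≡ x + (p * suc e + 1)
    e₁ = solve-∀
    e₂ : ∀ c Q → c * Q + Q ≡ (c + 1) * Q
    e₂ = solve-∀

  -- If pn > cQ + c, both factors of the quadratic bound exceed c (the second one by the upper end of
  -- the gap), and then their product exceeds pn.
  pn≤cQ+c : ∀ {n e} → a ≤ r → c * (Δ + t) + e ≡ n → e < Δ + t →
            QuadraticBound q (suc r) n (+ c) → p * n ≤ c * Q + c
  pn≤cQ+c {n} {e} a≤r n≡ e<θ bound with p * n ≤? c * Q + c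
  ... | yes pn≤ = pn≤
  ... | no  pn≰ with m≤n⇒∃[o]m+o≡n (≰⇒> pn≰) | m≤n⇒∃[o]m+o≡n (pn+c+2≤[c+1]Q n≡ e<θ)
  ...   | A , cQ+c+1+A≡pn | B , pn+c+2+B≡[c+1]Q =
    contradiction (QuadraticBound⇒*≤ {c = c} {Q} X Y cQ+X≡pn pn+Y≡[c+1]Q bound) (<⇒≱ pn<XY)
    where
    X : ℕ
    X = c + 1 + A
    Y : ℕ
    Y = c + 2 + B
    cQ+X≡pn : c * Q + X ≡ p * n
    cQ+X≡pn = trans (e₁ (c * Q) c A) cQ+c+1+A≡pn
      where
      e₁ : ∀ x c A → x + (c + 1 + A) ≡ suc (x + c) + A
      e₁ = solve-∀
    pn+Y≡[c+1]Q : p * n + Y ≡ (c + 1) * Q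
    pn+Y≡[c+1]Q = trans (e₂ (p * n) c B) pn+c+2+B≡[c+1]Q
      where
      e₂ : ∀ x c B → x + (c + 2 + B) ≡ x + c + 2 + B
      e₂ = solve-∀
    X+Y≡Q : X + Y ≡ Q
    X+Y≡Q = +-cancelˡ-≡ (c * Q) _ _ (begin-equality
      c * Q + (X + Y)   ≡⟨ +-assoc (c * Q) X Y ⟨
      c * Q + X + Y     ≡⟨ cong (_+ Y) cQ+X≡pn ⟩
      p * n + Y         ≡⟨ pn+Y≡[c+1]Q ⟩
      (c + 1) * Q       ≡⟨ e₃ c Q ⟩
      c * Q + Q         ∎)
      where
      e₃ : ∀ c Q → (c + 1) * Q ≡ c * Q + Q
      e₃ = solve-∀
    pn<XY : p * n < X * Y
    pn<XY = begin-strict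
      p * n             ≡⟨ cQ+X≡pn ⟨
      c * Q + X         ≡⟨ cong (λ S → c * S + X) X+Y≡Q ⟨
      c * (X + Y) + X   <⟨ quadratic-gap c A B (subst ((c + 1) * (c + 2) <_) (sym X+Y≡Q) ([c+1]*[c+2]<Q a≤r)) ⟩
      X * Y             ∎

  e≤2a+1 : ∀ {n e} → c * (Δ + t) + e ≡ n → p * n ≤ c * Q + c → e ≤ 2 * a + 1
  e≤2a+1 {n} {e} n≡ pn≤ = s≤s⁻¹ (*-cancelˡ-< p e (suc (2 * a + 1)) (begin-strict
    p * e                   ≤⟨ +-cancelˡ-≤ (c * Q) _ _ (begin
                                 c * Q + p * e ≡⟨ pn+c≡cQ+pe n≡ ⟨
                                 p * n + c     ≤⟨ +-monoˡ-≤ c pn≤ ⟩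
                                 c * Q + c + c ≡⟨ +-assoc (c * Q) c c ⟩
                                 c * Q + (c + c) ∎) ⟩
    c + c                   <⟨ +-mono-≤-< (m≤m+n c 1) (m<m+n c z<s) ⟩
    (c + 1) + (c + 1)       ≤⟨ +-mono-≤ c+1≤[a+1]*p c+1≤[a+1]*p ⟩
    (a + 1) * p + (a + 1) * p ≡⟨ e′ a p ⟩
    p * suc (2 * a + 1)     ∎))
    where
    e′ : ∀ a p → (a + 1) * p + (a + 1) * p ≡ p * suc (2 * a + 1)
    e′ = solve-∀

  c<J : ∀ {n n' e J} → c * (Δ + t) + e ≡ n → n' + J * Δ ≡ n → q * n' < n → a + 1 ≤ e → c < J
  c<J {n} {n'} {e} {J} n≡ n'≡ qn'<n a+1≤e = ≰⇒> λ J≤c → <-asym cQ<pn (<-≤-trans pn<JQ (*-monoˡ-≤ Q J≤c))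
    where
    pn<JQ : p * n < J * Q
    pn<JQ = +-cancelˡ-< n _ _ (begin-strict
      q * n             ≡⟨ cong (q *_) n'≡ ⟨
      q * (n' + J * Δ)  ≡⟨ e′ q n' J Δ ⟩
      q * n' + J * Q    <⟨ +-monoˡ-< (J * Q) qn'<n ⟩
      n + J * Q         ∎)
      where
      e′ : ∀ q n' J Δ → q * (n' + J * Δ) ≡ q * n' + J * (q * Δ)
      e′ = solve-∀
    cQ<pn : c * Q < p * n
    cQ<pn = +-cancelʳ-< c _ _ (begin-strict
      c * Q + c         <⟨ +-monoʳ-< (c * Q) (m<m+n c z<s) ⟩
      c * Q + (c + 1)   ≤⟨ +-monoʳ-≤ (c * Q) (≤-trans c+1≤[a+1]*p (≤-trans (≤-reflexive (*-comm (a + 1) p)) (*-monoʳ-≤ p a+1≤e))) ⟩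
      c * Q + p * e     ≡⟨ pn+c≡cQ+pe n≡ ⟨
      p * n + c         ∎)

  J≤c+a : ∀ {n n' e J} → c * (Δ + t) + e ≡ n → n' + J * Δ ≡ n → e ≤ t → J ≤ c + a
  J≤c+a {n} {n'} {e} {J} n≡ n'≡ e≤t = ≮⇒≥ λ c+a<J → <-irrefl refl (begin-strict
    n                              ≡⟨ n≡ ⟨
    c * (Δ + t) + e                ≤⟨ +-monoʳ-≤ (c * (Δ + t)) e≤t ⟩
    c * (Δ + t) + t                ≡⟨ e₁ c Δ t ⟩
    c * Δ + (c + 1) * t            ≤⟨ +-monoʳ-≤ (c * Δ) (*-monoˡ-≤ t c+1≤[a+1]*p) ⟩
    c * Δ + (a + 1) * p * t        <⟨ +-monoʳ-< (c * Δ) (m<m+n _ (m≤n+m 1 a)) ⟩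
    c * Δ + ((a + 1) * p * t + (a + 1)) ≡⟨ cong (_+_ (c * Δ)) (trans (cong ((a + 1) *_) Δ≡p*t+1) (e₂ a p t)) ⟨
    c * Δ + (a + 1) * Δ            ≡⟨ e₃ c a Δ ⟩
    suc (c + a) * Δ                ≤⟨ *-monoˡ-≤ Δ c+a<J ⟩
    J * Δ                          ≤⟨ m≤n+m (J * Δ) n' ⟩
    n' + J * Δ                     ≡⟨ n'≡ ⟩
    n                              ∎)
    where
    e₁ : ∀ c Δ t → c * (Δ + t) + t ≡ c * Δ + (c + 1) * t
    e₁ = solve-∀
    e₂ : ∀ a p t → (a + 1) * (p * t + 1) ≡ (a + 1) * p * t + (a + 1)
    e₂ = solve-∀
    e₃ : ∀ c a Δ → c * Δ + (a + 1) * Δ ≡ suc (c + a) * Δ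
    e₃ = solve-∀

  gap-below : ∀ {n' e} j a' → suc j + a' ≡ a → n' + (suc c + j) * Δ ≡ c * (Δ + t) + e →
              a + 1 ≤ e → e ≤ t + j → InGap q r a' b n'
  gap-below {n'} {e} j a' refl eq a+1≤e e≤t+j = lower , <⇒≤pred upper
    where
    c′ : ℕ
    c′ = a' * p + b
    n'+[1+j]≡ : n' + suc j ≡ c′ * t + e
    n'+[1+j]≡ = +-cancelʳ-≡ X _ _ (begin-equality
      n' + suc j + X                         ≡⟨ e₁ n' j c p t ⟩
      n' + (suc c + j) * (p * t + 1)         ≡⟨ cong (λ Δ → n' + (suc c + j) * Δ) Δ≡p*t+1 ⟨
      n' + (suc c + j) * Δ                   ≡⟨ eq ⟩
      c * (Δ + t) + e                        ≡⟨ cong (λ Δ → c * (Δ + t) + e) Δ≡p*t+1 ⟩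
      c * ((p * t + 1) + t) + e              ≡⟨ e₂ j a' p b t e ⟩
      c′ * t + e + X                         ∎)
      where
      X : ℕ
      X = c * (p * t + 1) + suc j * p * t
      e₁ : ∀ n' j c p t → n' + suc j + (c * (p * t + 1) + suc j * p * t) ≡ n' + (suc c + j) * (p * t + 1)
      e₁ = solve-∀
      e₂ : ∀ j a' p b t e → ((suc j + a') * p + b) * ((p * t + 1) + t) + e
                          ≡ (a' * p + b) * t + e + (((suc j + a') * p + b) * (p * t + 1) + suc j * p * t)
      e₂ = solve-∀
    lower : c′ * t + a' + 1 ≤ n'
    lower = +-cancelʳ-≤ (suc j) _ _ (begin
      c′ * t + a' + 1 + suc j     ≡⟨ e₃ (c′ * t) a' j ⟩
      c′ * t + (suc j + a' + 1)   ≤⟨ +-monoʳ-≤ (c′ * t) a+1≤e ⟩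
      c′ * t + e                  ≡⟨ n'+[1+j]≡ ⟨
      n' + suc j                  ∎)
      where
      e₃ : ∀ x a' j → x + a' + 1 + suc j ≡ x + (suc j + a' + 1)
      e₃ = solve-∀
    upper : n' < (c′ + 1) * t
    upper = +-cancelʳ-≤ (suc j) _ _ (begin
      suc n' + suc j              ≡⟨ cong suc n'+[1+j]≡ ⟩
      suc (c′ * t + e)            ≤⟨ s≤s (+-monoʳ-≤ (c′ * t) e≤t+j) ⟩
      suc (c′ * t + (t + j))      ≡⟨ e₄ c′ t j ⟩
      (c′ + 1) * t + suc j        ∎)
      where
      e₄ : ∀ c t j → suc (c * t + (t + j)) ≡ (c + 1) * t + suc j
      e₄ = solve-∀

  descend : ∀ {n' e J} → n' + J * Δ ≡ c * (Δ + t) + e → a + 1 ≤ e → e ≤ t → c < J → J ≤ c + a →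
            ∃ λ a' → a' < a × InGap q r a' b n'
  descend eq a+1≤e e≤t c<J J≤c+a with m≤n⇒∃[o]m+o≡n c<J
  ... | j , refl with m≤n⇒∃[o]m+o≡n (+-cancelˡ-≤ c (suc j) a (subst (_≤ c + a) (sym (+-suc c j)) J≤c+a))
  ... | a' , suc[j]+a'≡a = a' , subst (a' <_) suc[j]+a'≡a (m<n+m a' z<s) ,
                           gap-below j a' suc[j]+a'≡a eq a+1≤e (≤-trans e≤t (m≤m+n t j))

  gap-descent : ∀ {n n' J} → a ≤ r → InGap q (suc r) a b n → QuadraticBound q (suc r) n (+ c) →
                q * n' < n → n' + J * Δ ≡ n → ∃ λ a' → a' < a × InGap q r a' b n'
  gap-descent {n} {n'} {J} a≤r gap bound qn'<n n'≡ with excess gap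
  ... | e , n≡ , a+1≤e , e<θ =
    descend {n'} {e} {J} (trans n'≡ (sym n≡)) a+1≤e e≤t (c<J {n} {n'} n≡ n'≡ qn'<n a+1≤e) (J≤c+a {n} {n'} n≡ n'≡ e≤t)
    where
    e≤t : e ≤ t
    e≤t = ≤-trans (e≤2a+1 n≡ (pn≤cQ+c a≤r n≡ e<θ bound))
                  (≤-trans (+-monoˡ-≤ 1 (*-monoʳ-≤ 2 a≤r)) (2r+1≤θ p r 1≤p))

InGap-descent : ∀ q r a b {n n' J} → 2 ≤ q → b ≤ q ∸ 2 → a ≤ r → InGap q (suc r) a b n →
                QuadraticBound q (suc r) n (+ (a * (q ∸ 1) + b)) → q * n' < n → n' + J * q ^ suc r ≡ n →
                ∃ λ a' → a' < a × InGap q r a' b n'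
InGap-descent (suc p) r a b {n} {n'} {J} (s≤s 1≤p) b≤p∸1 =
  Descent.gap-descent p r a b (m≤pred[n]⇒suc[m]≤n {{>-nonZero 1≤p}} b≤p∸1) {n} {n'} {J}

module Representation (p r : ℕ) (1≤p : 1 ≤ p) where

  open ≤-Reasoning

  q : ℕ
  q = suc p
  t : ℕ
  t = θ q r
  Q : ℕ
  Q = q ^ (r + 1)

  instance
    p≢0 : NonZero p
    p≢0 = >-nonZero 1≤p
    t≢0 : NonZero t
    t≢0 = >-nonZero (≤-trans (m≤n+m 1 (2 * r)) (2r+1≤θ p r 1≤p))

  [n/t]*t+n%t≡n : ∀ n → n / t * t + n % t ≡ n
  [n/t]*t+n%t≡n n = sym (trans (m≡m%n+[m/n]*n n t) (+-comm (n % t) (n / t * t)))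

  Q≡p*t+1 : Q ≡ p * t + 1
  Q≡p*t+1 = trans (cong (q ^_) (+-comm r 1)) (sym (p*θ+1≡q^[1+r] p r))

  representable-large : ∀ {n c e} → c * t + e ≡ n → r * p ≤ c → n ≤ r * Q →
                        ∃₂ λ a b → n ≡ a * t + b * Q
  representable-large {n} {c} {e} n≡ rp≤c n≤rQ
    with m≤n⇒∃[o]m+o≡n (≤-trans (*-monoˡ-≤ t rp≤c) (≤-trans (m≤m+n (c * t) e) (≤-reflexive n≡)))
  ... | j , rpt+j≡n with m≤n⇒∃[o]m+o≡n (+-cancelˡ-≤ (r * p * t) j r (begin
        r * p * t + j     ≡⟨ rpt+j≡n ⟩
        n                 ≤⟨ n≤rQ ⟩
        r * Q             ≡⟨ cong (r *_) Q≡p*t+1 ⟩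
        r * (p * t + 1)   ≡⟨ e′ r p t ⟩
        r * p * t + r     ∎))
    where
    e′ : ∀ r p t → r * (p * t + 1) ≡ r * p * t + r
    e′ = solve-∀
  ... | s , refl = s * p , j , (begin-equality
        n                           ≡⟨ rpt+j≡n ⟨
        (j + s) * p * t + j         ≡⟨ e′ j s p t ⟩
        s * p * t + j * (p * t + 1) ≡⟨ cong (λ Q → s * p * t + j * Q) Q≡p*t+1 ⟨
        s * p * t + j * Q           ∎)
    where
    e′ : ∀ j s p t → (j + s) * p * t + j ≡ s * p * t + j * (p * t + 1)
    e′ = solve-∀

  representable-small : ∀ {n a b e} → (a * p + b) * t + e ≡ n → e ≤ a → ∃₂ λ a b → n ≡ a * t + b * Q
  representable-small {n} {a} {b} {e} n≡ e≤a with m≤n⇒∃[o]m+o≡n e≤a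
  ... | w , refl = w * p + b , e , (begin-equality
        n                                 ≡⟨ n≡ ⟨
        ((e + w) * p + b) * t + e         ≡⟨ e′ e w p b t ⟩
        (w * p + b) * t + e * (p * t + 1) ≡⟨ cong (λ Q → (w * p + b) * t + e * Q) Q≡p*t+1 ⟨
        (w * p + b) * t + e * Q           ∎)
    where
    e′ : ∀ e w p b t → ((e + w) * p + b) * t + e ≡ (w * p + b) * t + e * (p * t + 1)
    e′ = solve-∀

  representable-outside-gap : ∀ {n a b e} → (a * p + b) * t + e ≡ n → e < t → ¬ InGap q r a b n →
                              ∃₂ λ a b → n ≡ a * t + b * Q
  representable-outside-gap {n} {a} {b} {e} n≡ e<t ¬gap with e ≤? a
  ... | yes e≤a = representable-small n≡ e≤a
  ... | no  e≰a = contradiction (lower , <⇒≤pred upper) ¬gap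
    where
    lower : (a * p + b) * t + a + 1 ≤ n
    lower = begin
      (a * p + b) * t + a + 1   ≡⟨ +-assoc _ a 1 ⟩
      (a * p + b) * t + (a + 1) ≤⟨ +-monoʳ-≤ _ (≤-trans (≤-reflexive (+-comm a 1)) (≰⇒> e≰a)) ⟩
      (a * p + b) * t + e       ≡⟨ n≡ ⟩
      n                         ∎
    upper : n < (a * p + b + 1) * t
    upper = begin-strict
      n                         ≡⟨ n≡ ⟨
      (a * p + b) * t + e       <⟨ +-monoʳ-< _ e<t ⟩
      (a * p + b) * t + t       ≡⟨ e′ (a * p + b) t ⟩
      (a * p + b + 1) * t       ∎
      where
      e′ : ∀ c t → c * t + t ≡ (c + 1) * t
      e′ = solve-∀

  representable : ∀ n → (∀ a b → b ≤ q ∸ 2 → a ≤ r ∸ 1 → ¬ InGap q r a b n) → n ≤ r * Q →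
                  ∃₂ λ a b → n ≡ a * t + b * Q
  representable n gapFree n≤rQ with r * p ≤? n / t
  ... | yes rp≤c = representable-large ([n/t]*t+n%t≡n n) rp≤c n≤rQ
  ... | no  rp≰c = representable-outside-gap {n} {a} {b} n≡ (m%n<n n t) (gapFree a b (<⇒≤pred (m%n<n c p)) (<⇒≤pred a<r))
    where
    c : ℕ
    c = n / t
    a : ℕ
    a = c / p
    b : ℕ
    b = c % p
    c≡ap+b : a * p + b ≡ c
    c≡ap+b = trans (+-comm (a * p) b) (sym (m≡m%n+[m/n]*n c p))
    n≡ : (a * p + b) * t + n % t ≡ n
    n≡ = trans (cong (λ c → c * t + n % t) c≡ap+b) ([n/t]*t+n%t≡n n)
    a<r : a < r
    a<r = *-cancelʳ-< p a r (≤-<-trans (≤-trans (m≤m+n (a * p) b) (≤-reflexive c≡ap+b)) (≰⇒> rp≰c))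

gapFree⇒representable : ∀ q r n → 2 ≤ q →
                        (∀ a b → b ≤ q ∸ 2 → a ≤ r ∸ 1 → ¬ InGap q r a b n) →
                        n ≤ r * q ^ (r + 1) → ∃₂ λ a b → n ≡ a * θ q r + b * q ^ (r + 1)
gapFree⇒representable (suc p) r n (s≤s 1≤p) = Representation.representable p r 1≤p n

module _ (F : FiniteField) where

  open FiniteField F using (Carrier; elements; elements-unique; elements-complete; inverse)
    renaming (_≟_ to infix 4 _≟_)
  open PointSet

  commutativeRing : CommutativeRing 0ℓ 0ℓ
  commutativeRing = record { isCommutativeRing = FiniteField.isCommutativeRing F }

  open CommutativeRing commutativeRing using (0#; 1#; +-group; commutativeSemiring; ring)
    renaming (_+_ to _+ᶠ_; _*_ to _*ᶠ_; -_ to -ᶠ_; _-_ to _-ᶠ_;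
              +-identityʳ to +ᶠ-identityʳ; +-identityˡ to +ᶠ-identityˡ; *-comm to *ᶠ-comm; *-assoc to *ᶠ-assoc;
              *-identityʳ to *ᶠ-identityʳ; zeroʳ to *ᶠ-zeroʳ)
  open GroupProperties +-group using (x≈z//y; //-rightDividesˡ; y≈x\\z; \\-leftDividesˡ; inverseʳ-unique)
  open RingProperties ring using (-‿distribˡ-*)
  open SemiringSolver commutativeSemiring using (solve; _:+_; _:*_; _:=_)

  q : ℕ
  q = order F

  2≤q : 2 ≤ q
  2≤q = distinct-members (FiniteField.0≢1 F) (elements-complete 0#) (elements-complete 1#)
    where
    distinct-members : ∀ {xs : List Carrier} {x y} → ¬ x ≡ y → x ∈ xs → y ∈ xs → 2 ≤ length xs
    distinct-members {_ ∷ []}    x≢y (Any.here refl) (Any.here refl) = contradiction refl x≢y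
    distinct-members {_ ∷ _ ∷ _} _   _               _               = s≤s (s≤s z≤n)

  V : ℕ → Set
  V = Vec F

  IsZero : ∀ {v} → V v → Set
  IsZero u = ∀ k → u k ≡ 0#

  isZero? : ∀ {v} (u : V v) → Dec (IsZero u)
  isZero? u = Fin.all? (λ k → u k ≟ 0#)

  head≢0 : ∀ {v} (u : V (suc v)) → NonZeroVec F u → IsZero (tail u) → ¬ head u ≡ 0#
  head≢0 u u≢0 tail≡0 head≡0 = u≢0 λ { fzero → head≡0 ; (fsuc k) → tail≡0 k }

  vectors : ∀ v → List (V v)
  vectors zero    = (λ ()) ∷ []
  vectors (suc v) = concatMap (λ x → map (x ∷ᵛ_) (vectors v)) elements

  ∑-vectors : ∀ v (f : V (suc v) → ℕ) → ∑ (vectors (suc v)) f ≡ ∑ elements (λ x → ∑ (vectors v) (λ g → f (x ∷ᵛ g)))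
  ∑-vectors v f = trans (∑-concatMap elements _ f) (∑-cong elements (λ x → ∑-map (vectors v) (x ∷ᵛ_) f))

  length-vectors : ∀ v → length (vectors v) ≡ q ^ v
  length-vectors zero    = refl
  length-vectors (suc v) = begin
    length (vectors (suc v))                          ≡⟨ length≡∑1 (vectors (suc v)) ⟩
    ∑ (vectors (suc v)) (λ _ → 1)                      ≡⟨ ∑-vectors v (λ _ → 1) ⟩
    ∑ elements (λ _ → ∑ (vectors v) (λ _ → 1))         ≡⟨ ∑-cong elements (λ _ → sym (length≡∑1 (vectors v))) ⟩
    ∑ elements (λ _ → length (vectors v))              ≡⟨ ∑-const elements _ ⟩
    q * length (vectors v)                            ≡⟨ cong (q *_) (length-vectors v) ⟩
    q * q ^ v                                         ∎
    where open ≡-Reasoning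

  0ᵛ : ∀ v → V v
  0ᵛ zero    = λ ()
  0ᵛ (suc v) = 0# ∷ᵛ 0ᵛ v

  0ᵛ-isZero : ∀ v → IsZero (0ᵛ v)
  0ᵛ-isZero (suc v) fzero    = refl
  0ᵛ-isZero (suc v) (fsuc k) = 0ᵛ-isZero v k

  0ᵛ∈vectors : ∀ v → 0ᵛ v ∈ vectors v
  0ᵛ∈vectors zero    = Any.here refl
  0ᵛ∈vectors (suc v) = ∈-concatMap⁺ (λ x → map (x ∷ᵛ_) (vectors v)) (Any.map (λ { refl → ∈-map⁺ (0# ∷ᵛ_) (0ᵛ∈vectors v) }) (elements-complete 0#))

  dot-comm : ∀ {v} (g u : V v) → dot F g u ≡ dot F u g
  dot-comm {zero}  g u = refl
  dot-comm {suc v} g u = cong₂ _+ᶠ_ (*ᶠ-comm (head g) (head u)) (dot-comm (tail g) (tail u))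

  dot-zeroʳ : ∀ {v} (g u : V v) → IsZero u → dot F g u ≡ 0#
  dot-zeroʳ {zero}  g u u≡0 = refl
  dot-zeroʳ {suc v} g u u≡0 = begin
    head g *ᶠ head u +ᶠ dot F (tail g) (tail u) ≡⟨ cong₂ _+ᶠ_ (trans (cong (head g *ᶠ_) (u≡0 fzero)) (*ᶠ-zeroʳ (head g)))
                                                          (dot-zeroʳ (tail g) (tail u) (λ k → u≡0 (fsuc k))) ⟩
    0# +ᶠ 0#                                    ≡⟨ +ᶠ-identityʳ 0# ⟩
    0#                                          ∎
    where open ≡-Reasoning

  scaleAdd : ∀ {v} → Carrier → V v → V v → V v
  scaleAdd x w u k = x *ᶠ w k +ᶠ u k

  dot-scaleAddˡ : ∀ {v} x (g h u : V v) → dot F (scaleAdd x g h) u ≡ x *ᶠ dot F g u +ᶠ dot F h u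
  dot-scaleAddˡ {zero}  x g h u = sym (trans (cong (_+ᶠ 0#) (*ᶠ-zeroʳ x)) (+ᶠ-identityʳ 0#))
  dot-scaleAddˡ {suc v} x g h u = begin
    (x *ᶠ head g +ᶠ head h) *ᶠ head u +ᶠ dot F (scaleAdd x (tail g) (tail h)) (tail u)
      ≡⟨ cong ((x *ᶠ head g +ᶠ head h) *ᶠ head u +ᶠ_) (dot-scaleAddˡ x (tail g) (tail h) (tail u)) ⟩
    (x *ᶠ head g +ᶠ head h) *ᶠ head u +ᶠ (x *ᶠ dot F (tail g) (tail u) +ᶠ dot F (tail h) (tail u))
      ≡⟨ distribute x (head g) (head h) (head u) (dot F (tail g) (tail u)) (dot F (tail h) (tail u)) ⟩
    x *ᶠ (head g *ᶠ head u +ᶠ dot F (tail g) (tail u)) +ᶠ (head h *ᶠ head u +ᶠ dot F (tail h) (tail u)) ∎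
    where
    open ≡-Reasoning
    distribute : ∀ x g₀ h₀ u₀ G H → (x *ᶠ g₀ +ᶠ h₀) *ᶠ u₀ +ᶠ (x *ᶠ G +ᶠ H) ≡ x *ᶠ (g₀ *ᶠ u₀ +ᶠ G) +ᶠ (h₀ *ᶠ u₀ +ᶠ H)
    distribute = solve 6 (λ x g₀ h₀ u₀ G H → (x :* g₀ :+ h₀) :* u₀ :+ (x :* G :+ H) := x :* (g₀ :* u₀ :+ G) :+ (h₀ :* u₀ :+ H)) refl

  dot-scaleAddʳ : ∀ {v} x (g w u : V v) → dot F g (scaleAdd x w u) ≡ x *ᶠ dot F g w +ᶠ dot F g u
  dot-scaleAddʳ x g w u = trans (dot-comm g _) (trans (dot-scaleAddˡ x w u g) (cong₂ (λ a b → x *ᶠ a +ᶠ b) (dot-comm w g) (dot-comm u g)))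

  δ : Carrier → Carrier → ℕ
  δ x y = 𝟙 (x ≟ y)

  δ-yes : ∀ {x y} → x ≡ y → δ x y ≡ 1
  δ-yes {x} {y} = 𝟙-yes (x ≟ y)

  δ-shift : ∀ a s t → δ (a +ᶠ s) t ≡ δ s (-ᶠ a +ᶠ t)
  δ-shift a s t = 𝟙-cong (a +ᶠ s ≟ t) (s ≟ -ᶠ a +ᶠ t) (y≈x\\z a s t) (λ { refl → \\-leftDividesˡ a t })

  ∑-δ-line : ∀ {b} → ¬ b ≡ 0# → ∀ a t → ∑ elements (λ x → δ (x *ᶠ b +ᶠ a) t) ≡ 1
  ∑-δ-line {b} b≢0 a t with inverse b b≢0
  ... | b⁻¹ , bb⁻¹≡1 = trans (∑-single _ elements-unique (elements-complete x₀) off-x₀) (𝟙-yes (_ ≟ t) at-x₀)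
    where
    x₀ : Carrier
    x₀ = (t -ᶠ a) *ᶠ b⁻¹
    at-x₀ : x₀ *ᶠ b +ᶠ a ≡ t
    at-x₀ = begin
      (t -ᶠ a) *ᶠ b⁻¹ *ᶠ b +ᶠ a    ≡⟨ cong (_+ᶠ a) (*ᶠ-assoc (t -ᶠ a) b⁻¹ b) ⟩
      (t -ᶠ a) *ᶠ (b⁻¹ *ᶠ b) +ᶠ a  ≡⟨ cong (λ y → (t -ᶠ a) *ᶠ y +ᶠ a) (trans (*ᶠ-comm b⁻¹ b) bb⁻¹≡1) ⟩
      (t -ᶠ a) *ᶠ 1# +ᶠ a          ≡⟨ cong (_+ᶠ a) (*ᶠ-identityʳ (t -ᶠ a)) ⟩
      (t -ᶠ a) +ᶠ a                ≡⟨ //-rightDividesˡ a t ⟩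
      t                            ∎
      where open ≡-Reasoning
    solution : ∀ x → x *ᶠ b +ᶠ a ≡ t → x ≡ x₀
    solution x eq = begin
      x                  ≡⟨ *ᶠ-identityʳ x ⟨
      x *ᶠ 1#            ≡⟨ cong (x *ᶠ_) bb⁻¹≡1 ⟨
      x *ᶠ (b *ᶠ b⁻¹)    ≡⟨ *ᶠ-assoc x b b⁻¹ ⟨
      x *ᶠ b *ᶠ b⁻¹      ≡⟨ cong (_*ᶠ b⁻¹) (x≈z//y (x *ᶠ b) a t eq) ⟩
      (t -ᶠ a) *ᶠ b⁻¹    ∎
      where open ≡-Reasoning
    off-x₀ : ∀ x → ¬ x ≡ x₀ → δ (x *ᶠ b +ᶠ a) t ≡ 0
    off-x₀ x x≢x₀ = 𝟙-no (_ ≟ t) (x≢x₀ ∘ solution x)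

  -- Of the q + 1 values x·b + a (x ∈ F) and b exactly one vanishes, unless a = b = 0.
  pencil-count : ∀ a b → ∑ elements (λ x → δ (x *ᶠ b +ᶠ a) 0#) + δ b 0# ≡ 1 + q * (δ b 0# * δ a 0#)
  pencil-count a b with b ≟ 0#
  ... | no b≢0 = trans (cong (_+ 0) (∑-δ-line b≢0 a 0#)) (cong (_+_ 1) (sym (*-zeroʳ q)))
  ... | yes b≡0 = begin
    ∑ elements (λ x → δ (x *ᶠ b +ᶠ a) 0#) + 1 ≡⟨ cong (_+ 1) (∑-cong elements (λ x → cong (λ y → δ y 0#) (x*b+a≡a x))) ⟩
    ∑ elements (λ _ → δ a 0#) + 1             ≡⟨ cong (_+ 1) (∑-const elements (δ a 0#)) ⟩
    q * δ a 0# + 1                            ≡⟨ +-comm (q * δ a 0#) 1 ⟩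
    1 + q * δ a 0#                            ≡⟨ cong (λ y → 1 + q * y) (*-identityˡ (δ a 0#)) ⟨
    1 + q * (1 * δ a 0#)                      ∎
    where
    open ≡-Reasoning
    x*b+a≡a : ∀ x → x *ᶠ b +ᶠ a ≡ a
    x*b+a≡a x = trans (cong (λ b → x *ᶠ b +ᶠ a) b≡0) (trans (cong (_+ᶠ a) (*ᶠ-zeroʳ x)) (+ᶠ-identityˡ a))

  fibre : ∀ {v} → V v → Carrier → ℕ
  fibre {v} u t = ∑ (vectors v) (λ g → δ (dot F g u) t)

  q*fibre≡q^v : ∀ v (u : V v) → NonZeroVec F u → ∀ t → q * fibre u t ≡ q ^ v
  q*fibre≡q^v zero    u u≢0 t = ⊥-elim (u≢0 (λ ()))
  q*fibre≡q^v (suc v) u u≢0 t with isZero? (tail u)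
  ... | no tail≢0 = begin
    q * fibre u t
      ≡⟨ cong (q *_) (∑-vectors v _) ⟩
    q * ∑ elements (λ x → ∑ (vectors v) (λ g → δ (x *ᶠ head u +ᶠ dot F g (tail u)) t))
      ≡⟨ cong (q *_) (∑-cong elements (λ x → ∑-cong (vectors v) (λ g → δ-shift (x *ᶠ head u) _ t))) ⟩
    q * ∑ elements (λ x → fibre (tail u) (-ᶠ (x *ᶠ head u) +ᶠ t))
      ≡⟨ ∑-* elements q _ ⟨
    ∑ elements (λ x → q * fibre (tail u) (-ᶠ (x *ᶠ head u) +ᶠ t))
      ≡⟨ ∑-cong elements (λ x → q*fibre≡q^v v (tail u) tail≢0 _) ⟩
    ∑ elements (λ _ → q ^ v)
      ≡⟨ ∑-const elements (q ^ v) ⟩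
    q * q ^ v ∎
    where open ≡-Reasoning
  ... | yes tail≡0 = cong (q *_) (begin
    fibre u t
      ≡⟨ ∑-vectors v _ ⟩
    ∑ elements (λ x → ∑ (vectors v) (λ g → δ (x *ᶠ head u +ᶠ dot F g (tail u)) t))
      ≡⟨ ∑-cong elements (λ x → ∑-cong (vectors v) (λ g → cong (λ s → δ (x *ᶠ head u +ᶠ s) t) (dot-zeroʳ g (tail u) tail≡0))) ⟩
    ∑ elements (λ x → ∑ (vectors v) (λ _ → δ (x *ᶠ head u +ᶠ 0#) t))
      ≡⟨ ∑-cong elements (λ x → trans (∑-const (vectors v) _) (cong (_* δ (x *ᶠ head u +ᶠ 0#) t) (length-vectors v))) ⟩
    ∑ elements (λ x → q ^ v * δ (x *ᶠ head u +ᶠ 0#) t)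
      ≡⟨ ∑-* elements (q ^ v) _ ⟩
    q ^ v * ∑ elements (λ x → δ (x *ᶠ head u +ᶠ 0#) t)
      ≡⟨ cong (q ^ v *_) (∑-δ-line (head≢0 u u≢0 tail≡0) 0# t) ⟩
    q ^ v * 1
      ≡⟨ *-identityʳ (q ^ v) ⟩
    q ^ v ∎)
    where open ≡-Reasoning

  common : ∀ {v} → V v → V v → ℕ
  common {v} u w = ∑ (vectors v) (λ g → δ (dot F g u) 0# * δ (dot F g w) 0#)

  scaleAdd≢0 : ∀ {v} x (w u : V v) → ¬ SamePoint F u w → NonZeroVec F (scaleAdd x w u)
  scaleAdd≢0 x w u u≁w xw+u≡0 =
    u≁w (-ᶠ x , λ k → trans (inverseʳ-unique (x *ᶠ w k) (u k) (xw+u≡0 k)) (-‿distribˡ-* x (w k)))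

  -- Sum pencil-count over g along the line x·w + u, all of whose points are nonzero since u ≁ w.
  q*[q*common]≡q^v : ∀ v (u w : V v) → NonZeroVec F w → ¬ SamePoint F u w → q * (q * common u w) ≡ q ^ v
  q*[q*common]≡q^v v u w w≢0 u≁w = +-cancelˡ-≡ (q * q ^ v) _ _ (begin
    q * q ^ v + q * (q * common u w)
      ≡⟨ *-distribˡ-+ q (q ^ v) _ ⟨
    q * (q ^ v + q * common u w)
      ≡⟨ cong (q *_) pencil-sum ⟨
    q * (∑ elements (λ x → fibre (scaleAdd x w u) 0#) + fibre w 0#)
      ≡⟨ *-distribˡ-+ q _ _ ⟩
    q * ∑ elements (λ x → fibre (scaleAdd x w u) 0#) + q * fibre w 0#
      ≡⟨ cong₂ _+_ (sym (∑-* elements q _)) (q*fibre≡q^v v w w≢0 0#) ⟩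
    ∑ elements (λ x → q * fibre (scaleAdd x w u) 0#) + q ^ v
      ≡⟨ cong (_+ q ^ v) (∑-cong elements (λ x → q*fibre≡q^v v _ (scaleAdd≢0 x w u u≁w) 0#)) ⟩
    ∑ elements (λ _ → q ^ v) + q ^ v
      ≡⟨ cong (_+ q ^ v) (∑-const elements (q ^ v)) ⟩
    q * q ^ v + q ^ v ∎)
    where
    open ≡-Reasoning
    pencil-sum : ∑ elements (λ x → fibre (scaleAdd x w u) 0#) + fibre w 0# ≡ q ^ v + q * common u w
    pencil-sum = begin
      ∑ elements (λ x → fibre (scaleAdd x w u) 0#) + fibre w 0#
        ≡⟨ cong (_+ fibre w 0#) (∑-swap elements (vectors v) _) ⟩
      ∑ (vectors v) (λ g → ∑ elements (λ x → δ (dot F g (scaleAdd x w u)) 0#)) + fibre w 0#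
        ≡⟨ ∑-+ (vectors v) _ _ ⟨
      ∑ (vectors v) (λ g → ∑ elements (λ x → δ (dot F g (scaleAdd x w u)) 0#) + δ (dot F g w) 0#)
        ≡⟨ ∑-cong (vectors v) (λ g → trans (cong (_+ δ (dot F g w) 0#) (∑-cong elements (λ x → cong (λ y → δ y 0#) (dot-scaleAddʳ x g w u))))
                                            (pencil-count (dot F g u) (dot F g w))) ⟩
      ∑ (vectors v) (λ g → 1 + q * (δ (dot F g w) 0# * δ (dot F g u) 0#))
        ≡⟨ ∑-+ (vectors v) _ _ ⟩
      ∑ (vectors v) (λ _ → 1) + ∑ (vectors v) (λ g → q * (δ (dot F g w) 0# * δ (dot F g u) 0#))
        ≡⟨ cong₂ _+_ (trans (sym (length≡∑1 (vectors v))) (length-vectors v))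
                     (trans (∑-* (vectors v) q _) (cong (q *_) (∑-cong (vectors v) (λ g → *-comm (δ (dot F g w) 0#) _)))) ⟩
      q ^ v + q * common u w ∎

  kerCount : ∀ {v} → List (V v) → V v → ℕ
  kerCount L g = ∑ L (λ u → δ (dot F g u) 0#)

  first-moment : ∀ v (L : List (V v)) → All (NonZeroVec F) L → q * ∑ (vectors v) (kerCount L) ≡ length L * q ^ v
  first-moment v L L≢0 = begin
    q * ∑ (vectors v) (kerCount L) ≡⟨ cong (q *_) (∑-swap (vectors v) L _) ⟩
    q * ∑ L (λ u → fibre u 0#)      ≡⟨ ∑-* L q _ ⟨
    ∑ L (λ u → q * fibre u 0#)      ≡⟨ ∑-congᴬ (All.map (λ u≢0 → q*fibre≡q^v v _ u≢0 0#) L≢0) ⟩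
    ∑ L (λ _ → q ^ v)               ≡⟨ ∑-const L (q ^ v) ⟩
    length L * q ^ v                ∎
    where open ≡-Reasoning

  cross-moment : ∀ v (u : V v) (L : List (V v)) → All (NonZeroVec F) L → All (λ w → ¬ SamePoint F u w) L →
                 q * (q * ∑ (vectors v) (λ g → δ (dot F g u) 0# * kerCount L g)) ≡ length L * q ^ v
  cross-moment v u L L≢0 u≁L = begin
    q * (q * ∑ G (λ g → δᵤ g * kerCount L g))                ≡⟨ cong (λ s → q * (q * s)) (∑-cong G (λ g → sym (∑-* L (δᵤ g) _))) ⟩
    q * (q * ∑ G (λ g → ∑ L (λ w → δᵤ g * δ (dot F g w) 0#))) ≡⟨ cong (λ s → q * (q * s)) (∑-swap G L _) ⟩
    q * (q * ∑ L (common u))                                 ≡⟨ cong (q *_) (∑-* L q _) ⟨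
    q * ∑ L (λ w → q * common u w)                           ≡⟨ ∑-* L q _ ⟨
    ∑ L (λ w → q * (q * common u w))                         ≡⟨ ∑-congᴬ (All.zipWith (λ (w≢0 , u≁w) → q*[q*common]≡q^v v u _ w≢0 u≁w) (L≢0 , u≁L)) ⟩
    ∑ L (λ _ → q ^ v)                                        ≡⟨ ∑-const L (q ^ v) ⟩
    length L * q ^ v                                         ∎
    where
    open ≡-Reasoning
    G : List (V v)
    G = vectors v
    δᵤ : V v → ℕ
    δᵤ g = δ (dot F g u) 0#

  second-moment : ∀ v (L : List (V v)) → All (NonZeroVec F) L → AllPairs (λ u w → ¬ SamePoint F u w) L →
                  q * (q * ∑ (vectors v) (λ g → kerCount L g * kerCount L g)) + length L * q ^ v
                  ≡ (q * length L + length L * length L) * q ^ v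
  second-moment v [] [] [] = begin
    q * (q * ∑ (vectors v) (λ _ → 0)) + 0 ≡⟨ +-identityʳ _ ⟩
    q * (q * ∑ (vectors v) (λ _ → 0))     ≡⟨ cong (λ s → q * (q * s)) (trans (∑-const (vectors v) 0) (*-zeroʳ (length (vectors v)))) ⟩
    q * (q * 0)                           ≡⟨ cong (q *_) (*-zeroʳ q) ⟩
    q * 0                                 ≡⟨ *-zeroʳ q ⟩
    0                                     ≡⟨ cong (_* q ^ v) (trans (+-identityʳ (q * 0)) (*-zeroʳ q)) ⟨
    (q * 0 + 0) * q ^ v                   ∎
    where open ≡-Reasoning
  second-moment v (u ∷ L) (u≢0 ∷ L≢0) (u≁L ∷ L-distinct) = begin
    q * (q * ∑ G (λ g → (δᵤ g + K g) * (δᵤ g + K g))) + (1 + l) * P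
      ≡⟨ cong (λ s → q * (q * s) + (1 + l) * P) (∑-cong G square) ⟩
    q * (q * ∑ G (λ g → δᵤ g + 2 * (δᵤ g * K g) + K g * K g)) + (1 + l) * P
      ≡⟨ cong (λ s → q * (q * s) + (1 + l) * P) split ⟩
    q * (q * (fibre u 0# + 2 * ∑ G (λ g → δᵤ g * K g) + ∑ G (λ g → K g * K g))) + (1 + l) * P
      ≡⟨ expand q (fibre u 0#) (∑ G (λ g → δᵤ g * K g)) (∑ G (λ g → K g * K g)) l P ⟩
    q * (q * fibre u 0#) + 2 * (q * (q * ∑ G (λ g → δᵤ g * K g))) + (q * (q * ∑ G (λ g → K g * K g)) + l * P) + P
      ≡⟨ cong₂ (λ x y → x + y + (q * (q * ∑ G (λ g → K g * K g)) + l * P) + P) (cong (q *_) (q*fibre≡q^v v u u≢0 0#)) (cong (2 *_) (cross-moment v u L L≢0 u≁L)) ⟩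
    q * P + 2 * (l * P) + (q * (q * ∑ G (λ g → K g * K g)) + l * P) + P
      ≡⟨ cong (λ x → q * P + 2 * (l * P) + x + P) (second-moment v L L≢0 L-distinct) ⟩
    q * P + 2 * (l * P) + (q * l + l * l) * P + P
      ≡⟨ collect q l P ⟩
    (q * (1 + l) + (1 + l) * (1 + l)) * P ∎
    where
    open ≡-Reasoning
    G : List (V v)
    G = vectors v
    P : ℕ
    P = q ^ v
    l : ℕ
    l = length L
    δᵤ : V v → ℕ
    δᵤ g = δ (dot F g u) 0#
    K : V v → ℕ
    K = kerCount L
    square : ∀ g → (δᵤ g + K g) * (δᵤ g + K g) ≡ δᵤ g + 2 * (δᵤ g * K g) + K g * K g
    square g = trans (e (δᵤ g) (K g)) (cong (λ x → x + 2 * (δᵤ g * K g) + K g * K g) (𝟙-idem (dot F g u ≟ 0#)))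
      where
      e : ∀ a b → (a + b) * (a + b) ≡ a * a + 2 * (a * b) + b * b
      e = solve-∀
    split : ∑ G (λ g → δᵤ g + 2 * (δᵤ g * K g) + K g * K g) ≡ fibre u 0# + 2 * ∑ G (λ g → δᵤ g * K g) + ∑ G (λ g → K g * K g)
    split = trans (∑-+ G _ _) (cong (_+ ∑ G (λ g → K g * K g)) (trans (∑-+ G _ _) (cong (_+_ (fibre u 0#)) (∑-* G 2 _))))
    expand : ∀ q f c s l P → q * (q * (f + 2 * c + s)) + (1 + l) * P ≡ q * (q * f) + 2 * (q * (q * c)) + (q * (q * s) + l * P) + P
    expand = solve-∀
    collect : ∀ q l P → q * P + 2 * (l * P) + (q * l + l * l) * P + P ≡ (q * (1 + l) + (1 + l) * (1 + l)) * P
    collect = solve-∀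

  kerCount-0 : ∀ {v} (L : List (V v)) g → IsZero g → kerCount L g ≡ length L
  kerCount-0 L g g≡0 = trans (∑-cong L (λ u → δ-yes (trans (dot-comm g u) (dot-zeroʳ u g g≡0)))) (sym (length≡∑1 L))

  kerCount≡size : ∀ r {v} (C : PointSet F v) → Divisible F r C → ∀ g → kerCount (reps C) g ≡ size F C mod q ^ r
  kerCount≡size r C C-div g with isZero? g
  ... | yes g≡0 = subst (λ k → k ≡ size F C mod q ^ r) (sym (kerCount-0 (reps C) g g≡0)) (≡-mod-refl {size F C})
  ... | no  g≢0 = subst (λ k → k ≡ size F C mod q ^ r) (length-filter≡∑𝟙 _ (reps C)) (ℤ∣.∣ᵤ⇒∣ (C-div g g≢0))

  _∩ker_ : ∀ {v} → PointSet F v → V v → PointSet F v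
  C ∩ker g = record
    { reps     = filter (λ u → dot F g u ≟ 0#) (reps C)
    ; nonzero  = Allₚ.filter⁺ _ (nonzero C)
    ; distinct = AllPairsₚ.filter⁺ _ (distinct C)
    }

  size-∩ker : ∀ {v} (C : PointSet F v) g → size F (C ∩ker g) ≡ kerCount (reps C) g
  size-∩ker C g = length-filter≡∑𝟙 _ (reps C)

  pointsIn-∩ker : ∀ {v} (C : PointSet F v) g h →
                  pointsIn F (C ∩ker g) h ≡ ∑ (reps C) (λ u → δ (dot F g u) 0# * δ (dot F h u) 0#)
  pointsIn-∩ker C g h = trans (length-filter≡∑𝟙 _ (reps (C ∩ker g))) (∑-filter _ (reps C) _)

  kernel-pencil : ∀ {v} (L : List (V v)) g h →
                  ∑ elements (λ x → kerCount L (scaleAdd x g h)) + kerCount L g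
                  ≡ length L + q * ∑ L (λ u → δ (dot F g u) 0# * δ (dot F h u) 0#)
  kernel-pencil L g h = begin
    ∑ elements (λ x → kerCount L (scaleAdd x g h)) + kerCount L g
      ≡⟨ cong (_+ kerCount L g) (∑-swap elements L _) ⟩
    ∑ L (λ u → ∑ elements (λ x → δ (dot F (scaleAdd x g h) u) 0#)) + kerCount L g
      ≡⟨ ∑-+ L _ _ ⟨
    ∑ L (λ u → ∑ elements (λ x → δ (dot F (scaleAdd x g h) u) 0#) + δ (dot F g u) 0#)
      ≡⟨ ∑-cong L (λ u → trans (cong (_+ δ (dot F g u) 0#) (∑-cong elements (λ x → cong (λ y → δ y 0#) (dot-scaleAddˡ x g h u))))
                                (pencil-count (dot F h u) (dot F g u))) ⟩
    ∑ L (λ u → 1 + q * (δ (dot F g u) 0# * δ (dot F h u) 0#))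
      ≡⟨ ∑-+ L _ _ ⟩
    ∑ L (λ _ → 1) + ∑ L (λ u → q * (δ (dot F g u) 0# * δ (dot F h u) 0#))
      ≡⟨ cong₂ _+_ (sym (length≡∑1 L)) (∑-* L q _) ⟩
    length L + q * ∑ L (λ u → δ (dot F g u) 0# * δ (dot F h u) 0#) ∎
    where open ≡-Reasoning

  instance
    q≢0 : NonZero q
    q≢0 = >-nonZero (≤-trans (s≤s z≤n) 2≤q)

  -- Both x·g + h and g are hyperplanes (or the whole space) of a q^(r+1)-divisible set, so the pencil
  -- identity gives q·|C ∩ ker g ∩ ker h| ≡ q·|C| modulo q^(r+1).
  restrict : ∀ r {v} (C : PointSet F v) → Divisible F (suc r) C → ∀ g → Divisible F r (C ∩ker g)
  restrict r {v} C C-div g h _ = ℤ∣.∣⇒∣ᵤ (subst₂ (λ a b → a ≡ b mod q ^ r) (sym (pointsIn-∩ker C g h)) (sym (size-∩ker C g)) K₂≡Kg)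
    where
    L : List (V v)
    L = reps C
    n : ℕ
    n = length L
    K₂ : ℕ
    K₂ = ∑ L (λ u → δ (dot F g u) 0# * δ (dot F h u) 0#)
    S : ℕ
    S = ∑ elements (λ x → kerCount L (scaleAdd x g h))
    qq^r≡ : + (q ^ suc r) ≡ + q ℤ.* + (q ^ r)
    qq^r≡ = ℤ.pos-* q (q ^ r)
    S≡qn : S ≡ q * n mod q ^ suc r
    S≡qn = ∑-≡-mod elements (λ x → kerCount≡size (suc r) C C-div (scaleAdd x g h))
    Kg≡n : kerCount L g ≡ n mod q ^ suc r
    Kg≡n = kerCount≡size (suc r) C C-div g
    qK₂≡qn : + q ℤ.* + (q ^ r) ∣ℤ + q ℤ.* (+ K₂ ℤ.- + n)
    qK₂≡qn = subst₂ _∣ℤ_ qq^r≡ (trans (cong (λ qn → (+ S ℤ.- qn) ℤ.+ (+ kerCount L g ℤ.- + n)) (ℤ.pos-* q n)) regroup)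
                    (ℤ∣.∣m∣n⇒∣m+n S≡qn Kg≡n)
      where
      pencil : + S ℤ.+ + kerCount L g ≡ + n ℤ.+ + q ℤ.* + K₂
      pencil = trans (sym (ℤ.pos-+ S _)) (trans (cong +_ (kernel-pencil L g h)) (trans (ℤ.pos-+ n _) (cong (λ k → + n ℤ.+ k) (ℤ.pos-* q K₂))))
      regroup : (+ S ℤ.- + q ℤ.* + n) ℤ.+ (+ kerCount L g ℤ.- + n) ≡ + q ℤ.* (+ K₂ ℤ.- + n)
      regroup = trans (e₁ (+ S) (+ kerCount L g) (+ q) (+ n)) (trans (cong (λ s → s ℤ.- (+ q ℤ.* + n ℤ.+ + n)) pencil) (e₂ (+ n) (+ q) (+ K₂)))
        where
        e₁ : ∀ s k q n → (s ℤ.- q ℤ.* n) ℤ.+ (k ℤ.- n) ≡ (s ℤ.+ k) ℤ.- (q ℤ.* n ℤ.+ n)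
        e₁ = ℤ-Solver.solve-∀
        e₂ : ∀ n q k → (n ℤ.+ q ℤ.* k) ℤ.- (q ℤ.* n ℤ.+ n) ≡ q ℤ.* (k ℤ.- n)
        e₂ = ℤ-Solver.solve-∀
    K₂≡Kg : K₂ ≡ kerCount L g mod q ^ r
    K₂≡Kg = subst (+ (q ^ r) ∣ℤ_) (e (+ K₂) (+ kerCount L g) (+ n))
                  (ℤ∣.∣m∣n⇒∣m-n (ℤ∣.*-cancelˡ-∣ (+ q) qK₂≡qn) (ℤ∣.∣-trans (divides (+ q) qq^r≡) Kg≡n))
      where
      e : ∀ a b c → (a ℤ.- c) ℤ.- (b ℤ.- c) ≡ a ℤ.- b
      e = ℤ-Solver.solve-∀

  moment-identity : ∀ {v} (C : PointSet F v) (α β : ℤ) →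
    let K = kerCount (reps C) ; n = + size F C ; P = + (q ^ v) in
    + q ℤ.* + q ℤ.* ∑ᶻ (vectors v) (λ g → (+ K g ℤ.- α) ℤ.* (+ K g ℤ.- β))
    ≡ (+ q ℤ.* n ℤ.+ n ℤ.* n ℤ.- n) ℤ.* P ℤ.- (α ℤ.+ β) ℤ.* + q ℤ.* (n ℤ.* P) ℤ.+ α ℤ.* β ℤ.* + q ℤ.* + q ℤ.* P
  moment-identity {v} C α β = begin
    + q ℤ.* + q ℤ.* ∑ᶻ G (λ g → (+ K g ℤ.- α) ℤ.* (+ K g ℤ.- β))
      ≡⟨ cong (+ q ℤ.* + q ℤ.*_) (∑ᶻ-quadratic G K α β) ⟩
    + q ℤ.* + q ℤ.* (+ S₂ ℤ.- (α ℤ.+ β) ℤ.* + S₁ ℤ.+ α ℤ.* β ℤ.* + length G)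
      ≡⟨ e (+ q) (+ S₂) (+ S₁) (+ length G) α β ⟩
    + q ℤ.* (+ q ℤ.* + S₂) ℤ.- (α ℤ.+ β) ℤ.* + q ℤ.* (+ q ℤ.* + S₁) ℤ.+ α ℤ.* β ℤ.* + q ℤ.* + q ℤ.* + length G
      ≡⟨ cong₂ (λ x y → x ℤ.- (α ℤ.+ β) ℤ.* + q ℤ.* y ℤ.+ α ℤ.* β ℤ.* + q ℤ.* + q ℤ.* + length G) second first ⟩
    (+ q ℤ.* + n ℤ.+ + n ℤ.* + n ℤ.- + n) ℤ.* + P ℤ.- (α ℤ.+ β) ℤ.* + q ℤ.* (+ n ℤ.* + P) ℤ.+ α ℤ.* β ℤ.* + q ℤ.* + q ℤ.* + length G
      ≡⟨ cong (λ z → (+ q ℤ.* + n ℤ.+ + n ℤ.* + n ℤ.- + n) ℤ.* + P ℤ.- (α ℤ.+ β) ℤ.* + q ℤ.* (+ n ℤ.* + P) ℤ.+ α ℤ.* β ℤ.* + q ℤ.* + q ℤ.* + z) (length-vectors v) ⟩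
    (+ q ℤ.* + n ℤ.+ + n ℤ.* + n ℤ.- + n) ℤ.* + P ℤ.- (α ℤ.+ β) ℤ.* + q ℤ.* (+ n ℤ.* + P) ℤ.+ α ℤ.* β ℤ.* + q ℤ.* + q ℤ.* + P ∎
    where
    open ≡-Reasoning
    G : List (V v)
    G = vectors v
    K : V v → ℕ
    K = kerCount (reps C)
    n : ℕ
    n = size F C
    P : ℕ
    P = q ^ v
    S₁ : ℕ
    S₁ = ∑ G K
    S₂ : ℕ
    S₂ = ∑ G (λ g → K g * K g)
    e : ∀ q s₂ s₁ l α β → q ℤ.* q ℤ.* (s₂ ℤ.- (α ℤ.+ β) ℤ.* s₁ ℤ.+ α ℤ.* β ℤ.* l)
                       ≡ q ℤ.* (q ℤ.* s₂) ℤ.- (α ℤ.+ β) ℤ.* q ℤ.* (q ℤ.* s₁) ℤ.+ α ℤ.* β ℤ.* q ℤ.* q ℤ.* l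
    e = ℤ-Solver.solve-∀
    first : + q ℤ.* + S₁ ≡ + n ℤ.* + P
    first = trans (sym (ℤ.pos-* q S₁)) (trans (cong +_ (first-moment v (reps C) (nonzero C))) (ℤ.pos-* n P))
    second : + q ℤ.* (+ q ℤ.* + S₂) ≡ (+ q ℤ.* + n ℤ.+ + n ℤ.* + n ℤ.- + n) ℤ.* + P
    second = begin
      + q ℤ.* (+ q ℤ.* + S₂)                     ≡⟨ cong (+ q ℤ.*_) (ℤ.pos-* q S₂) ⟨
      + q ℤ.* + (q * S₂)                         ≡⟨ ℤ.pos-* q (q * S₂) ⟨
      + (q * (q * S₂))                           ≡⟨ +a≡+c-+b (second-moment v (reps C) (nonzero C) (distinct C)) ⟩
      + ((q * n + n * n) * P) ℤ.- + (n * P)      ≡⟨ cong₂ ℤ._-_ (trans (ℤ.pos-* (q * n + n * n) P) (cong (ℤ._* + P) (trans (ℤ.pos-+ (q * n) _) (cong₂ ℤ._+_ (ℤ.pos-* q n) (ℤ.pos-* n n))))) (ℤ.pos-* n P) ⟩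
      (+ q ℤ.* + n ℤ.+ + n ℤ.* + n) ℤ.* + P ℤ.- + n ℤ.* + P ≡⟨ e′ (+ q ℤ.* + n ℤ.+ + n ℤ.* + n) (+ n) (+ P) ⟩
      (+ q ℤ.* + n ℤ.+ + n ℤ.* + n ℤ.- + n) ℤ.* + P ∎
      where
      e′ : ∀ a n P → a ℤ.* P ℤ.- n ℤ.* P ≡ (a ℤ.- n) ℤ.* P
      e′ = ℤ-Solver.solve-∀

  -- Σ_g (K_g − α)(K_g − β) ≥ 0, because every K_g is congruent to n and α, β = n − (c+1)q^r, n − c·q^r
  -- are consecutive in that residue class.
  quadratic-bound : ∀ r {v} (C : PointSet F v) → Divisible F r C → ∀ c → QuadraticBound q r (size F C) c
  quadratic-bound r {v} C C-div c =
    ℤ.0≤i-j⇒j≤i (ℤ.*-cancelˡ-≤-pos (+ 0) _ (+ (q ^ v)) {{P>0}} (subst₂ ℤ._≤_ (sym (ℤ.*-zeroʳ (+ (q ^ v)))) key ∑≥0))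
    where
    n : ℕ
    n = size F C
    p : ℕ
    p = q ∸ 1
    Δ : ℤ
    Δ = + (q ^ r)
    α : ℤ
    α = + n ℤ.- (c ℤ.+ + 1) ℤ.* Δ
    β : ℤ
    β = + n ℤ.- c ℤ.* Δ
    K : V v → ℕ
    K = kerCount (reps C)
    P>0 : ℤ.Positive (+ (q ^ v))
    P>0 = ℤ.positive (ℤ.+<+ (m^n>0 q v))
    ∑≥0 : + 0 ℤ.≤ + q ℤ.* + q ℤ.* ∑ᶻ (vectors v) (λ g → (+ K g ℤ.- α) ℤ.* (+ K g ℤ.- β))
    ∑≥0 = subst (λ k → + 0 ℤ.≤ k ℤ.* ∑ᶻ (vectors v) (λ g → (+ K g ℤ.- α) ℤ.* (+ K g ℤ.- β))) (ℤ.pos-* q q)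
            (+k*i≥0 (q * q) (∑ᶻ-nonneg (vectors v) _ (λ g → consecutive-multiples (q ^ r) c (kerCount≡size r C C-div g))))
    +q≡p+1 : + q ≡ + p ℤ.+ + 1
    +q≡p+1 = trans (cong +_ (sym (m∸n+n≡m (≤-trans (s≤s z≤n) 2≤q)))) (ℤ.pos-+ p 1)
    key : + q ℤ.* + q ℤ.* ∑ᶻ (vectors v) (λ g → (+ K g ℤ.- α) ℤ.* (+ K g ℤ.- β))
          ≡ + (q ^ v) ℤ.* (+ (p * n) ℤ.- (+ (p * n) ℤ.- c ℤ.* + (q ^ suc r)) ℤ.* ((c ℤ.+ + 1) ℤ.* + (q ^ suc r) ℤ.- + (p * n)))
    key = begin
      + q ℤ.* + q ℤ.* ∑ᶻ (vectors v) (λ g → (+ K g ℤ.- α) ℤ.* (+ K g ℤ.- β))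
        ≡⟨ moment-identity C α β ⟩
      (+ q ℤ.* + n ℤ.+ + n ℤ.* + n ℤ.- + n) ℤ.* P ℤ.- (α ℤ.+ β) ℤ.* + q ℤ.* (+ n ℤ.* P) ℤ.+ α ℤ.* β ℤ.* + q ℤ.* + q ℤ.* P
        ≡⟨ cong (λ q → (q ℤ.* + n ℤ.+ + n ℤ.* + n ℤ.- + n) ℤ.* P ℤ.- (α ℤ.+ β) ℤ.* q ℤ.* (+ n ℤ.* P) ℤ.+ α ℤ.* β ℤ.* q ℤ.* q ℤ.* P) +q≡p+1 ⟩
      ((+ p ℤ.+ + 1) ℤ.* + n ℤ.+ + n ℤ.* + n ℤ.- + n) ℤ.* P ℤ.- (α ℤ.+ β) ℤ.* (+ p ℤ.+ + 1) ℤ.* (+ n ℤ.* P) ℤ.+ α ℤ.* β ℤ.* (+ p ℤ.+ + 1) ℤ.* (+ p ℤ.+ + 1) ℤ.* P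
        ≡⟨ e (+ p) (+ n) P Δ c ⟩
      P ℤ.* (+ p ℤ.* + n ℤ.- (+ p ℤ.* + n ℤ.- c ℤ.* ((+ p ℤ.+ + 1) ℤ.* Δ)) ℤ.* ((c ℤ.+ + 1) ℤ.* ((+ p ℤ.+ + 1) ℤ.* Δ) ℤ.- + p ℤ.* + n))
        ≡⟨ cong₂ (λ pn Q → P ℤ.* (pn ℤ.- (pn ℤ.- c ℤ.* Q) ℤ.* ((c ℤ.+ + 1) ℤ.* Q ℤ.- pn))) (sym (ℤ.pos-* p n))
                 (trans (cong (ℤ._* Δ) (sym +q≡p+1)) (sym (ℤ.pos-* q (q ^ r)))) ⟩
      P ℤ.* (+ (p * n) ℤ.- (+ (p * n) ℤ.- c ℤ.* + (q ^ suc r)) ℤ.* ((c ℤ.+ + 1) ℤ.* + (q ^ suc r) ℤ.- + (p * n))) ∎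
      where
      open ≡-Reasoning
      P : ℤ
      P = + (q ^ v)
      e : ∀ p n P Δ c →
          ((p ℤ.+ + 1) ℤ.* n ℤ.+ n ℤ.* n ℤ.- n) ℤ.* P
            ℤ.- ((n ℤ.- (c ℤ.+ + 1) ℤ.* Δ) ℤ.+ (n ℤ.- c ℤ.* Δ)) ℤ.* (p ℤ.+ + 1) ℤ.* (n ℤ.* P)
            ℤ.+ (n ℤ.- (c ℤ.+ + 1) ℤ.* Δ) ℤ.* (n ℤ.- c ℤ.* Δ) ℤ.* (p ℤ.+ + 1) ℤ.* (p ℤ.+ + 1) ℤ.* P
          ≡ P ℤ.* (p ℤ.* n ℤ.- (p ℤ.* n ℤ.- c ℤ.* ((p ℤ.+ + 1) ℤ.* Δ)) ℤ.* ((c ℤ.+ + 1) ℤ.* ((p ℤ.+ + 1) ℤ.* Δ) ℤ.- p ℤ.* n))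
      e = ℤ-Solver.solve-∀

  -- Over all functionals g the average of q·|C ∩ ker g| is |C|, and the zero functional exceeds it.
  averaging : ∀ {v} (C : PointSet F v) → 1 ≤ size F C → ∃ λ g → q * kerCount (reps C) g < size F C
  averaging {v} C 1≤n = ∑-≡⇒∃< (vectors v) sums≡ (0ᵛ∈vectors v) n<q*K₀
    where
    n : ℕ
    n = size F C
    K : V v → ℕ
    K = kerCount (reps C)
    sums≡ : ∑ (vectors v) (λ g → q * K g) ≡ ∑ (vectors v) (λ _ → n)
    sums≡ = begin
      ∑ (vectors v) (λ g → q * K g)  ≡⟨ ∑-* (vectors v) q K ⟩
      q * ∑ (vectors v) K            ≡⟨ first-moment v (reps C) (nonzero C) ⟩
      n * q ^ v                      ≡⟨ *-comm n (q ^ v) ⟩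
      q ^ v * n                      ≡⟨ cong (_* n) (length-vectors v) ⟨
      length (vectors v) * n         ≡⟨ ∑-const (vectors v) n ⟨
      ∑ (vectors v) (λ _ → n)        ∎
      where open ≡-Reasoning
    n<q*K₀ : n < q * K (0ᵛ v)
    n<q*K₀ = subst (λ k → n < q * k) (sym (kerCount-0 (reps C) (0ᵛ v) (0ᵛ-isZero v)))
               (subst (_< q * n) (*-identityˡ n) (*-monoˡ-< n {{>-nonZero 1≤n}} 2≤q))

  gap-section : ∀ r {v} (C : PointSet F v) → Divisible F (suc r) C → ∀ a b → b ≤ q ∸ 2 → a ≤ r →
                InGap q (suc r) a b (size F C) → ∃₂ λ g a' → a' < a × InGap q r a' b (size F (C ∩ker g))
  -- The implicit sizes are passed explicitly: inferring them would unfold the decision procedures in kerCount.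
  gap-section r C C-div a b b≤q-2 a≤r gap =
    let g , q*n'<n      = averaging C (≤-trans (m≤n+m 1 _) (proj₁ gap))
        J , n'+JΔ≡n     = ≡-mod⇒∃ (≤-trans (m≤n*m _ q) (<⇒≤ q*n'<n)) (kerCount≡size (suc r) C C-div g)
        a' , a'<a , gap′ = InGap-descent q r a b {size F C} {kerCount (reps C) g} {J} 2≤q b≤q-2 a≤r gap
                             (quadratic-bound (suc r) C C-div (+ (a * (q ∸ 1) + b))) q*n'<n n'+JΔ≡n
    in g , a' , a'<a , subst (InGap q r a' b) (sym (size-∩ker C g)) gap′

  gap-free : ∀ r {v} (C : PointSet F v) → Divisible F (suc r) C →
             ∀ a b → b ≤ q ∸ 2 → a ≤ r → ¬ InGap q (suc r) a b (size F C)
  gap-free zero C C-div a b b≤q-2 a≤0 gap =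
    let _ , _ , a'<a , _ = gap-section zero C C-div a b b≤q-2 a≤0 gap
    in contradiction (<-≤-trans a'<a a≤0) λ ()
  gap-free (suc r) C C-div a b b≤q-2 a≤r gap =
    let g , a' , a'<a , gap′ = gap-section (suc r) C C-div a b b≤q-2 a≤r gap
    in gap-free r (C ∩ker g) (restrict (suc r) C C-div g) a' b b≤q-2 (s≤s⁻¹ (<-≤-trans a'<a a≤r)) gap′

theorem12 : (F : FiniteField) → (r v : ℕ) → 1 ≤ r → (C : PointSet F v) → Divisible F r C →
    ((a b : ℕ) → b ≤ order F ∸ 2 → a ≤ r ∸ 1 →
    ¬ ((a * (order F ∸ 1) + b) * θ (order F) r + a + 1 ≤ size F C
    × size F C ≤ (a * (order F ∸ 1) + b + 1) * θ (order F) r ∸ 1))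
    × (size F C ≤ r * order F ^ (r + 1) →
    ∃₂ λ a b → size F C ≡ a * θ (order F) r + b * order F ^ (r + 1))
theorem12 F zero    v ()        C C-div
theorem12 F (suc r) v (s≤s z≤n) C C-div =
  gap-free F r C C-div , gapFree⇒representable (order F) (suc r) (size F C) (2≤q F) (gap-free F r C C-div)
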